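{- Let $n\ge0$ be an integer and let $S_n=F_nU_n^{ -1}$, a linear operator on the space $\mathcal P_n$ of complex polynomials of degree at most $n$. Then $S_n$ is invertible and for every $p=0,1,\dots,n$, $$S_n^{ -1}x^p=\frac{p!\,(n-p)!}{(2n)!}\sum_{m=p}^{n}\binom{ -n}{m-p}\binom{2n}{n-m}x^m .$$
   Context: The Euler polynomials $A_k(x)$ are defined by $\frac{A_k(x)}{(1-x)^{k+1}}=\sum_{m\ge0}m^kx^m$, with $A_0=1$. Linear operators on $\mathcal P_n$ are given on monomials $x^p$, $p=0,\dots,n$: $U_n x^p=\frac1{n!}(1-x)^{n-p}A_p(x)=(1-x)^{n+1}\frac1{n!}\sum_{m\ge0}m^px^m$ (invertible, with $U_n^{ -1}x^p=(x)_p[x+1]_{n-p}$, where $(\varphi)_k=\varphi(\varphi-1)\cdots(\varphi-k+1)$, $[\varphi]_k=\varphi(\varphi+1)\cdots(\varphi+k-1)$, both $=1$ for $k=0$); $F_n x^p=(1-x)^{2n+1}\sum_{m\ge0}m^p\binom{m+n}{n}x^m$ (a polynomial of degree $\le n$; $0^0=1$). Binomial coefficients with negative upper entry are $\binom{c}{k}=c(c-1)\cdots(c-k+1)/k!$. -}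

module Defs where

open import Data.Nat as ℕ using (ℕ; zero; suc; _∸_; _!)
open import Data.Nat.Properties using (_!≢0)
open import Data.Nat.Combinatorics using (_C_)
open import Data.Integer as ℤ using (ℤ; +_)
open import Data.Rational using (ℚ; _/_; 0ℚ; 1ℚ; _+_; _*_; -_)
open import Data.Fin using (Fin; toℕ)
open import Relation.Nullary using (yes; no)
open import Data.List using (List; []; _∷_)

ℤ→ℚ : ℤ → ℚ
ℤ→ℚ z = z / 1

ℕ→ℚ : ℕ → ℚ
ℕ→ℚ k = (+ k) / 1

sgn : ℕ → ℚ
sgn zero = 1ℚ
sgn (suc i) = - sgn i

Σ≤ : ℕ → (ℕ → ℚ) → ℚ
Σ≤ zero f = f 0
Σ≤ (suc j) f = Σ≤ j f + f (suc j)

ΣFin : (n : ℕ) → (Fin n → ℚ) → ℚ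
ΣFin zero f = 0ℚ
ΣFin (suc n) f = f Fin.zero + ΣFin n (λ k → f (Fin.suc k))

fallingℤ : ℤ → ℕ → ℤ
fallingℤ c zero = + 1
fallingℤ c (suc k) = fallingℤ c k ℤ.* (c ℤ.- (+ k))

binomℤ : ℤ → ℕ → ℚ
binomℤ c k = fallingℤ c k / (k !)
  where instance _ = k !≢0

-- Polynomials with rational coefficients as coefficient lists
-- (constant term first)

Poly : Set
Poly = List ℚ

padd : Poly → Poly → Poly
padd [] q = q
padd (a ∷ p) [] = a ∷ p
padd (a ∷ p) (b ∷ q) = (a + b) ∷ padd p q

pscale : ℚ → Poly → Poly
pscale c [] = []
pscale c (a ∷ p) = (c * a) ∷ pscale c p

pmul : Poly → Poly → Poly
pmul [] q = []
pmul (a ∷ p) q = padd (pscale a q) (0ℚ ∷ pmul p q)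

coeff : Poly → ℕ → ℚ
coeff [] j = 0ℚ
coeff (a ∷ p) zero = a
coeff (a ∷ p) (suc j) = coeff p j

xPlus : ℚ → Poly
xPlus c = c ∷ 1ℚ ∷ []

fallingX : ℕ → Poly
fallingX zero = 1ℚ ∷ []
fallingX (suc p) = pmul (fallingX p) (xPlus (- ℕ→ℚ p))

risingX1 : ℕ → Poly
risingX1 zero = 1ℚ ∷ []
risingX1 (suc k) = pmul (risingX1 k) (xPlus (ℕ→ℚ (suc k)))

-- Linear operators on 𝒫_n, represented by their matrices in the
-- monomial basis 1, x, …, x^n:  M j p = coefficient of x^j in M(x^p).

Mat : ℕ → Set
Mat n = Fin (suc n) → Fin (suc n) → ℚ

_∘M_ : ∀ {n} → Mat n → Mat n → Mat n
_∘M_ {n} A B j p = ΣFin (suc n) (λ k → A j k * B k p)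

idM : ∀ {n} → Mat n
idM j p with toℕ j ℕ.≟ toℕ p
... | yes _ = 1ℚ
... | no _ = 0ℚ

Uinv : (n : ℕ) → Mat n
Uinv n j p = coeff (pmul (fallingX (toℕ p)) (risingX1 (n ∸ toℕ p))) (toℕ j)

-- F_n x^p = (1-x)^{2n+1} Σ_{m≥0} m^p C(m+n,n) x^m ; its coefficient of
-- x^j is the Cauchy product  Σ_{i=0}^{j} (-1)^i C(2n+1,i) (j-i)^p C(j-i+n,n)
-- (with 0^0 = 1, as ℕ._^_ does).
F : (n : ℕ) → Mat n
F n j p = Σ≤ (toℕ j) (λ i →
  sgn i * ℕ→ℚ (suc (2 ℕ.* n) C i)
        * ℕ→ℚ (((toℕ j ∸ i) ℕ.^ toℕ p) ℕ.* ((toℕ j ∸ i ℕ.+ n) C n)))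

S : (n : ℕ) → Mat n
S n = F n ∘M Uinv n

T : (n : ℕ) → Mat n
T n m p with toℕ p ℕ.≤? toℕ m
... | yes _ =
      ((+ (toℕ p ! ℕ.* (n ∸ toℕ p) !)) / ((2 ℕ.* n) !))
      * binomℤ (ℤ.- (+ n)) (toℕ m ∸ toℕ p)
      * ℕ→ℚ ((2 ℕ.* n) C (n ∸ toℕ m))
  where instance _ = (2 ℕ.* n) !≢0
... | no _ = 0ℚ

module Submission where

-- The proof computes the matrix of S_n explicitly and then checks both
-- products with T_n entry by entry.
--
-- U_n⁻¹ x^p = (x)_p [x+1]_(n-p) takes the value
-- n! C(m+k, n) at m ∈ ℕ (k = n - p), so S_n x^p = n! (1-x)^(2n+1) G(x) with
-- G(x) = Σ_m C(m+n,n) C(m+k,n) x^m.  Vandermonde's convolution and trinomial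
-- revision split G into pieces x^(p+t) (1-x)^-(n+p+t+1); after multiplying by
-- (1-x)^(2n+1) one is left with x^p Σ_t C(k,t) f(t) x^t (1-x)^(k-t), whose
-- coefficients are read off from Newton's forward-difference form.  Hence
-- S_n x^p = n! Σ_{j ≥ p} C(n-p, j-p) C(n+p, j) x^j.
--
-- S_n and T_n are lower triangular, and after clearing factorials
-- (three factorial identities) each entry of S_n T_n and of T_n S_n is a
-- coefficient of (1+x)^-n (1+x)^n = 1 (module TriangularInverse).

open import Defs
open import Data.Nat as ℕ using (ℕ; zero; suc; _∸_; _!; _≤_; _<_; z≤n; s≤s; NonZero)
import Data.Nat.Properties as ℕP
open import Data.Nat.Combinatorics using (_C_; nCk+nC[k+1]≡[n+1]C[k+1]; k>n⇒nCk≡0; nCn≡1; nCk≡nC[n∸k]; nCk≡n!/k![n-k]!; k![n∸k]!∣n!)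
open import Data.Nat.DivMod using (m*[n/m]≡n)
import Data.Nat.Tactic.RingSolver as ℕ-Ring
open import Data.Integer as ℤ using (ℤ)
import Data.Integer.Properties as ℤP
import Data.Integer.Tactic.RingSolver as ℤ-Ring
open import Data.Rational using (ℚ; 0ℚ; 1ℚ; _+_; _*_; -_; _/_; toℚᵘ; fromℚᵘ)
open import Data.Rational.Properties
import Data.Rational.Unnormalised as ℚᵘ
import Data.Rational.Unnormalised.Properties as ℚᵘP
open import Data.Rational.Solver using (module +-*-Solver)
open import Data.Fin using (Fin; toℕ)
import Data.Fin.Properties as FinP
open import Data.List using ([]; _∷_; length)
open import Data.Product using (_×_; _,_)
open import Data.Sum using (inj₁; inj₂; [_,_]′)
open import Function using (_∘_)
open import Relation.Binary.PropositionalEquality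
open import Relation.Binary.Bundles using (Setoid)
import Relation.Binary.Reasoning.Setoid as SetoidReasoning
open import Relation.Nullary using (yes; no)
open import Relation.Nullary.Negation using (contradiction)

open +-*-Solver

-- The casts ℤ → ℚ and ℕ → ℚ are ring homomorphisms.  Since ℤ→ℚ z is
-- definitionally fromℚᵘ (z / 1), this follows from fromℚᵘ being one.
fromℚᵘ-+ : ∀ u v → fromℚᵘ (u ℚᵘ.+ v) ≡ fromℚᵘ u + fromℚᵘ v
fromℚᵘ-+ u v = toℚᵘ-injective (begin
  toℚᵘ (fromℚᵘ (u ℚᵘ.+ v))              ≈⟨ toℚᵘ-fromℚᵘ (u ℚᵘ.+ v) ⟩
  u ℚᵘ.+ v                              ≈⟨ ℚᵘP.+-cong (ℚᵘP.≃-sym (toℚᵘ-fromℚᵘ u)) (ℚᵘP.≃-sym (toℚᵘ-fromℚᵘ v)) ⟩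
  toℚᵘ (fromℚᵘ u) ℚᵘ.+ toℚᵘ (fromℚᵘ v)  ≈⟨ ℚᵘP.≃-sym (toℚᵘ-homo-+ (fromℚᵘ u) (fromℚᵘ v)) ⟩
  toℚᵘ (fromℚᵘ u + fromℚᵘ v)            ∎)
  where open ℚᵘP.≃-Reasoning

fromℚᵘ-* : ∀ u v → fromℚᵘ (u ℚᵘ.* v) ≡ fromℚᵘ u * fromℚᵘ v
fromℚᵘ-* u v = toℚᵘ-injective (begin
  toℚᵘ (fromℚᵘ (u ℚᵘ.* v))              ≈⟨ toℚᵘ-fromℚᵘ (u ℚᵘ.* v) ⟩
  u ℚᵘ.* v                              ≈⟨ ℚᵘP.*-cong (ℚᵘP.≃-sym (toℚᵘ-fromℚᵘ u)) (ℚᵘP.≃-sym (toℚᵘ-fromℚᵘ v)) ⟩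
  toℚᵘ (fromℚᵘ u) ℚᵘ.* toℚᵘ (fromℚᵘ v)  ≈⟨ ℚᵘP.≃-sym (toℚᵘ-homo-* (fromℚᵘ u) (fromℚᵘ v)) ⟩
  toℚᵘ (fromℚᵘ u * fromℚᵘ v)            ∎)
  where open ℚᵘP.≃-Reasoning

ℤ→ℚ-+ : ∀ a b → ℤ→ℚ (a ℤ.+ b) ≡ ℤ→ℚ a + ℤ→ℚ b
ℤ→ℚ-+ a b = trans (fromℚᵘ-cong {ℚᵘ.mkℚᵘ (a ℤ.+ b) 0} {ℚᵘ.mkℚᵘ a 0 ℚᵘ.+ ℚᵘ.mkℚᵘ b 0} (ℚᵘ.*≡* (same-fraction a b)))
  (fromℚᵘ-+ (ℚᵘ.mkℚᵘ a 0) (ℚᵘ.mkℚᵘ b 0))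
  where
  same-fraction : ∀ a b → (a ℤ.+ b) ℤ.* (ℤ.+ 1 ℤ.* ℤ.+ 1) ≡ (a ℤ.* ℤ.+ 1 ℤ.+ b ℤ.* ℤ.+ 1) ℤ.* ℤ.+ 1
  same-fraction = ℤ-Ring.solve-∀

ℤ→ℚ-* : ∀ a b → ℤ→ℚ (a ℤ.* b) ≡ ℤ→ℚ a * ℤ→ℚ b
ℤ→ℚ-* a b = fromℚᵘ-* (ℚᵘ.mkℚᵘ a 0) (ℚᵘ.mkℚᵘ b 0)

ℕ→ℚ-+ : ∀ a b → ℕ→ℚ (a ℕ.+ b) ≡ ℕ→ℚ a + ℕ→ℚ b
ℕ→ℚ-+ a b = ℤ→ℚ-+ (ℤ.+ a) (ℤ.+ b)

ℕ→ℚ-* : ∀ a b → ℕ→ℚ (a ℕ.* b) ≡ ℕ→ℚ a * ℕ→ℚ b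
ℕ→ℚ-* a b = trans (cong ℤ→ℚ (ℤP.pos-* a b)) (ℤ→ℚ-* (ℤ.+ a) (ℤ.+ b))

ℕ→ℚ-∸ : ∀ m p → p ≤ m → ℕ→ℚ (m ∸ p) ≡ ℕ→ℚ m + - ℕ→ℚ p
ℕ→ℚ-∸ m p p≤m = begin
  ℕ→ℚ (m ∸ p)                    ≡⟨ solve 2 (λ a b → a := a :+ b :+ :- b) refl (ℕ→ℚ (m ∸ p)) (ℕ→ℚ p) ⟩
  ℕ→ℚ (m ∸ p) + ℕ→ℚ p + - ℕ→ℚ p  ≡⟨ cong (_+ - ℕ→ℚ p) (sym (ℕ→ℚ-+ (m ∸ p) p)) ⟩
  ℕ→ℚ (m ∸ p ℕ.+ p) + - ℕ→ℚ p    ≡⟨ cong (λ z → ℕ→ℚ z + - ℕ→ℚ p) (ℕP.m∸n+n≡m p≤m) ⟩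
  ℕ→ℚ m + - ℕ→ℚ p                ∎
  where open ≡-Reasoning

recip : (d : ℕ) → .{{NonZero d}} → ℚ
recip d = (ℤ.+ 1) / d

recip-inverse : ∀ d .{{_ : NonZero d}} → recip d * ℕ→ℚ d ≡ 1ℚ
recip-inverse (suc d) = trans (sym (fromℚᵘ-* (ℚᵘ.mkℚᵘ (ℤ.+ 1) d) (ℚᵘ.mkℚᵘ (ℤ.+ suc d) 0)))
  (fromℚᵘ-cong {ℚᵘ.mkℚᵘ (ℤ.+ 1) d ℚᵘ.* ℚᵘ.mkℚᵘ (ℤ.+ suc d) 0} {ℚᵘ.mkℚᵘ (ℤ.+ 1) 0}
    (ℚᵘ.*≡* (cong (λ x → ℤ.+ suc x) (same-fraction d))))
  where
  same-fraction : ∀ d → (d ℕ.+ 0) ℕ.* 1 ≡ d ℕ.* 1 ℕ.+ 0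
  same-fraction = ℕ-Ring.solve-∀

/-as-recip : ∀ z d .{{_ : NonZero d}} → z / d ≡ ℤ→ℚ z * recip d
/-as-recip z (suc d) = trans (fromℚᵘ-cong {ℚᵘ.mkℚᵘ z d} {ℚᵘ.mkℚᵘ z 0 ℚᵘ.* ℚᵘ.mkℚᵘ (ℤ.+ 1) d}
    (ℚᵘ.*≡* (cong₂ ℤ._*_ (sym (ℤP.*-identityʳ z)) (cong ℤ.+_ (ℕP.*-identityˡ (suc d))))))
  (fromℚᵘ-* (ℚᵘ.mkℚᵘ z 0) (ℚᵘ.mkℚᵘ (ℤ.+ 1) d))

ℕ→ℚ-*-cancelˡ : ∀ d .{{_ : NonZero d}} {x y} → ℕ→ℚ d * x ≡ ℕ→ℚ d * y → x ≡ y
ℕ→ℚ-*-cancelˡ d {x} {y} eq = begin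
  x                      ≡⟨ sym (trans (cong (_* x) (recip-inverse d)) (*-identityˡ x)) ⟩
  recip d * ℕ→ℚ d * x    ≡⟨ *-assoc (recip d) (ℕ→ℚ d) x ⟩
  recip d * (ℕ→ℚ d * x)  ≡⟨ cong (recip d *_) eq ⟩
  recip d * (ℕ→ℚ d * y)  ≡⟨ sym (*-assoc (recip d) (ℕ→ℚ d) y) ⟩
  recip d * ℕ→ℚ d * y    ≡⟨ trans (cong (_* y) (recip-inverse d)) (*-identityˡ y) ⟩
  y                      ∎
  where open ≡-Reasoning

/-*-cancel : ∀ a d .{{_ : NonZero d}} → ((ℤ.+ a) / d) * ℕ→ℚ d ≡ ℕ→ℚ a
/-*-cancel a d = begin
  ((ℤ.+ a) / d) * ℕ→ℚ d      ≡⟨ cong (_* ℕ→ℚ d) (/-as-recip (ℤ.+ a) d) ⟩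
  ℕ→ℚ a * recip d * ℕ→ℚ d    ≡⟨ *-assoc (ℕ→ℚ a) (recip d) (ℕ→ℚ d) ⟩
  ℕ→ℚ a * (recip d * ℕ→ℚ d)  ≡⟨ cong (ℕ→ℚ a *_) (recip-inverse d) ⟩
  ℕ→ℚ a * 1ℚ                 ≡⟨ *-identityʳ (ℕ→ℚ a) ⟩
  ℕ→ℚ a                      ∎
  where open ≡-Reasoning

Σ≤-cong : ∀ j {f g : ℕ → ℚ} → (∀ i → f i ≡ g i) → Σ≤ j f ≡ Σ≤ j g
Σ≤-cong zero    f≡g = f≡g 0
Σ≤-cong (suc j) f≡g = cong₂ _+_ (Σ≤-cong j f≡g) (f≡g (suc j))

Σ≤-cong-≤ : ∀ j {f g : ℕ → ℚ} → (∀ i → i ≤ j → f i ≡ g i) → Σ≤ j f ≡ Σ≤ j g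
Σ≤-cong-≤ zero    f≡g = f≡g 0 z≤n
Σ≤-cong-≤ (suc j) f≡g =
  cong₂ _+_ (Σ≤-cong-≤ j (λ i i≤j → f≡g i (ℕP.m≤n⇒m≤1+n i≤j))) (f≡g (suc j) ℕP.≤-refl)

Σ≤-zero : ∀ j (f : ℕ → ℚ) → (∀ i → i ≤ j → f i ≡ 0ℚ) → Σ≤ j f ≡ 0ℚ
Σ≤-zero zero    f f≡0 = f≡0 0 z≤n
Σ≤-zero (suc j) f f≡0 = trans (cong₂ _+_ (Σ≤-zero j f (λ i i≤j → f≡0 i (ℕP.m≤n⇒m≤1+n i≤j))) (f≡0 (suc j) ℕP.≤-refl))
  (+-identityʳ 0ℚ)

Σ≤-+ : ∀ j (f g : ℕ → ℚ) → Σ≤ j (λ i → f i + g i) ≡ Σ≤ j f + Σ≤ j g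
Σ≤-+ zero    f g = refl
Σ≤-+ (suc j) f g = trans (cong (_+ (f (suc j) + g (suc j))) (Σ≤-+ j f g))
  (solve 4 (λ a b c d → (a :+ b) :+ (c :+ d) := (a :+ c) :+ (b :+ d)) refl
     (Σ≤ j f) (Σ≤ j g) (f (suc j)) (g (suc j)))

Σ≤-*ˡ : ∀ j c (f : ℕ → ℚ) → c * Σ≤ j f ≡ Σ≤ j (λ i → c * f i)
Σ≤-*ˡ zero    c f = refl
Σ≤-*ˡ (suc j) c f = trans (*-distribˡ-+ c (Σ≤ j f) (f (suc j))) (cong (_+ (c * f (suc j))) (Σ≤-*ˡ j c f))

Σ≤-*ʳ : ∀ j (f : ℕ → ℚ) c → Σ≤ j f * c ≡ Σ≤ j (λ i → f i * c)
Σ≤-*ʳ j f c = trans (*-comm (Σ≤ j f) c) (trans (Σ≤-*ˡ j c f) (Σ≤-cong j (λ i → *-comm c (f i))))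

Σ≤-first : ∀ j (f : ℕ → ℚ) → Σ≤ (suc j) f ≡ f 0 + Σ≤ j (f ∘ suc)
Σ≤-first zero    f = refl
Σ≤-first (suc j) f = trans (cong (_+ f (suc (suc j))) (Σ≤-first j f))
  (+-assoc (f 0) (Σ≤ j (f ∘ suc)) (f (suc (suc j))))

Σ≤-swap : ∀ a b (h : ℕ → ℕ → ℚ) → Σ≤ a (λ t → Σ≤ b (h t)) ≡ Σ≤ b (λ i → Σ≤ a (λ t → h t i))
Σ≤-swap zero    b h = refl
Σ≤-swap (suc a) b h = trans (cong (_+ Σ≤ b (h (suc a))) (Σ≤-swap a b h))
  (sym (Σ≤-+ b (λ i → Σ≤ a (λ t → h t i)) (h (suc a))))

Σ≤-drop-tail : ∀ j n (f : ℕ → ℚ) → j ≤ n → (∀ i → j < i → f i ≡ 0ℚ) → Σ≤ n f ≡ Σ≤ j f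
Σ≤-drop-tail j zero    f z≤n _   = refl
Σ≤-drop-tail j (suc n) f j≤n f≡0 with ℕP.m≤n⇒m<n∨m≡n j≤n
... | inj₁ j<1+n = trans (cong₂ _+_ (Σ≤-drop-tail j n f (ℕP.≤-pred j<1+n) f≡0) (f≡0 (suc n) j<1+n))
                         (+-identityʳ (Σ≤ j f))
... | inj₂ refl  = refl

Σ≤-drop-head : ∀ p t (f : ℕ → ℚ) → (∀ i → i < p → f i ≡ 0ℚ) → Σ≤ (p ℕ.+ t) f ≡ Σ≤ t (λ s → f (p ℕ.+ s))
Σ≤-drop-head zero    t f f≡0 = refl
Σ≤-drop-head (suc p) t f f≡0 = begin
  Σ≤ (suc p ℕ.+ t) f                 ≡⟨ Σ≤-first (p ℕ.+ t) f ⟩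
  f 0 + Σ≤ (p ℕ.+ t) (f ∘ suc)       ≡⟨ cong₂ _+_ (f≡0 0 (s≤s z≤n)) (Σ≤-drop-head p t (f ∘ suc) (λ i i<p → f≡0 (suc i) (s≤s i<p))) ⟩
  0ℚ + Σ≤ t (λ s → f (suc p ℕ.+ s))  ≡⟨ +-identityˡ _ ⟩
  Σ≤ t (λ s → f (suc p ℕ.+ s))       ∎
  where open ≡-Reasoning

ΣFin-Σ≤ : ∀ n (f : Fin (suc n) → ℚ) (g : ℕ → ℚ) → (∀ k → f k ≡ g (toℕ k)) → ΣFin (suc n) f ≡ Σ≤ n g
ΣFin-Σ≤ zero    f g f≡g = trans (+-identityʳ (f Fin.zero)) (f≡g Fin.zero)
ΣFin-Σ≤ (suc n) f g f≡g = begin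
  f Fin.zero + ΣFin (suc n) (f ∘ Fin.suc)  ≡⟨ cong₂ _+_ (f≡g Fin.zero) (ΣFin-Σ≤ n (f ∘ Fin.suc) (g ∘ suc) (f≡g ∘ Fin.suc)) ⟩
  g 0 + Σ≤ n (g ∘ suc)                     ≡⟨ sym (Σ≤-first n g) ⟩
  Σ≤ (suc n) g                             ∎
  where open ≡-Reasoning

Σ≤-reverse : ∀ j (f : ℕ → ℚ) → Σ≤ j f ≡ Σ≤ j (λ i → f (j ∸ i))
Σ≤-reverse zero    f = refl
Σ≤-reverse (suc j) f = begin
  Σ≤ (suc j) f                        ≡⟨ Σ≤-first j f ⟩
  f 0 + Σ≤ j (f ∘ suc)                ≡⟨ cong (f 0 +_) (Σ≤-reverse j (f ∘ suc)) ⟩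
  f 0 + Σ≤ j (λ i → f (suc (j ∸ i)))  ≡⟨ +-comm (f 0) _ ⟩
  Σ≤ j (λ i → f (suc (j ∸ i))) + f 0  ≡⟨ cong (_+ f 0) (Σ≤-cong-≤ j (λ i i≤j → cong f (sym (ℕP.+-∸-assoc 1 i≤j)))) ⟩
  Σ≤ j (λ i → f (suc j ∸ i)) + f 0    ≡⟨ cong (λ z → Σ≤ j (λ i → f (suc j ∸ i)) + f z) (sym (ℕP.n∸n≡0 j)) ⟩
  Σ≤ (suc j) (λ i → f (suc j ∸ i))    ∎
  where open ≡-Reasoning

-- n C k as a rational number.  It is kept opaque: unfolding it during
-- conversion checking would expose the gcd computations inside ℕ→ℚ.
opaque
  binom : ℕ → ℕ → ℚ
  binom n k = ℕ→ℚ (n C k)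

opaque
  unfolding binom

  binom-def : ∀ n k → binom n k ≡ ℕ→ℚ (n C k)
  binom-def n k = refl

binom-pascal : ∀ n k → binom (suc n) (suc k) ≡ binom n k + binom n (suc k)
binom-pascal n k = begin
  binom (suc n) (suc k)          ≡⟨ binom-def (suc n) (suc k) ⟩
  ℕ→ℚ (suc n C suc k)            ≡⟨ cong ℕ→ℚ (sym (nCk+nC[k+1]≡[n+1]C[k+1] n k)) ⟩
  ℕ→ℚ ((n C k) ℕ.+ (n C suc k))  ≡⟨ ℕ→ℚ-+ (n C k) (n C suc k) ⟩
  ℕ→ℚ (n C k) + ℕ→ℚ (n C suc k)  ≡⟨ sym (cong₂ _+_ (binom-def n k) (binom-def n (suc k))) ⟩
  binom n k + binom n (suc k)    ∎
  where open ≡-Reasoning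

binom-vanish : ∀ n k → n < k → binom n k ≡ 0ℚ
binom-vanish n k n<k = trans (binom-def n k) (cong ℕ→ℚ (k>n⇒nCk≡0 n<k))

binom-diagonal : ∀ n → binom n n ≡ 1ℚ
binom-diagonal n = trans (binom-def n n) (cong ℕ→ℚ (nCn≡1 n))

binom-zero : ∀ n → binom n 0 ≡ 1ℚ
binom-zero n = binom-def n 0

binom-symmetric : ∀ {n k} → k ≤ n → binom n k ≡ binom n (n ∸ k)
binom-symmetric {n} {k} k≤n = trans (binom-def n k) (trans (cong ℕ→ℚ (nCk≡nC[n∸k] k≤n)) (sym (binom-def n (n ∸ k))))

binom-* : ∀ a b c d → binom a b * binom c d ≡ ℕ→ℚ ((a C b) ℕ.* (c C d))
binom-* a b c d = trans (cong₂ _*_ (binom-def a b) (binom-def c d)) (sym (ℕ→ℚ-* (a C b) (c C d)))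

C-factorial : ∀ a b N → a ℕ.+ b ≡ N → (N C a) ℕ.* (a ! ℕ.* b !) ≡ N !
C-factorial a b N refl = begin
  (N C a) ℕ.* (a ! ℕ.* b !)                            ≡⟨ cong (λ z → (N C a) ℕ.* (a ! ℕ.* z !)) (sym (ℕP.m+n∸m≡n a b)) ⟩
  (N C a) ℕ.* (a ! ℕ.* (N ∸ a) !)                      ≡⟨ ℕP.*-comm (N C a) _ ⟩
  a ! ℕ.* (N ∸ a) ! ℕ.* (N C a)                        ≡⟨ cong (a ! ℕ.* (N ∸ a) ! ℕ.*_) (nCk≡n!/k![n-k]! a≤N) ⟩
  a ! ℕ.* (N ∸ a) ! ℕ.* (N ! ℕ./ (a ! ℕ.* (N ∸ a) !))  ≡⟨ m*[n/m]≡n (k![n∸k]!∣n! a≤N) ⟩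
  N !                                                  ∎
  where
  open ≡-Reasoning
  instance _ = a ℕP.!* (N ∸ a) !≢0
  a≤N : a ≤ N
  a≤N = ℕP.m≤m+n a b

C-absorb : ∀ N r → (suc N C suc r) ℕ.* suc r ≡ suc N ℕ.* (N C r)
C-absorb N r with r ℕ.≤? N
... | no r≰N = begin
  (suc N C suc r) ℕ.* suc r  ≡⟨ cong (ℕ._* suc r) (k>n⇒nCk≡0 (s≤s (ℕP.≰⇒> r≰N))) ⟩
  0                          ≡⟨ sym (ℕP.*-zeroʳ (suc N)) ⟩
  suc N ℕ.* 0                ≡⟨ cong (suc N ℕ.*_) (sym (k>n⇒nCk≡0 (ℕP.≰⇒> r≰N))) ⟩
  suc N ℕ.* (N C r)          ∎
  where open ≡-Reasoning
... | yes r≤N = ℕP.*-cancelʳ-≡ _ _ (r ! ℕ.* (N ∸ r) !) {{r ℕP.!* (N ∸ r) !≢0}} (begin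
  (suc N C suc r) ℕ.* suc r ℕ.* (r ! ℕ.* (N ∸ r) !)  ≡⟨ reassoc (suc N C suc r) (suc r) (r !) ((N ∸ r) !) ⟩
  (suc N C suc r) ℕ.* (suc r ! ℕ.* (N ∸ r) !)        ≡⟨ C-factorial (suc r) (N ∸ r) (suc N) (cong suc (ℕP.m+[n∸m]≡n r≤N)) ⟩
  suc N ℕ.* N !                                      ≡⟨ cong (suc N ℕ.*_) (sym (C-factorial r (N ∸ r) N (ℕP.m+[n∸m]≡n r≤N))) ⟩
  suc N ℕ.* ((N C r) ℕ.* (r ! ℕ.* (N ∸ r) !))        ≡⟨ sym (ℕP.*-assoc (suc N) (N C r) _) ⟩
  suc N ℕ.* (N C r) ℕ.* (r ! ℕ.* (N ∸ r) !)          ∎)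
  where
  open ≡-Reasoning
  reassoc : ∀ x s f g → x ℕ.* s ℕ.* (f ℕ.* g) ≡ x ℕ.* (s ℕ.* f ℕ.* g)
  reassoc = ℕ-Ring.solve-∀

C-absorb′ : ∀ m p → (m C p) ℕ.* (m ∸ p) ≡ (m C suc p) ℕ.* suc p
C-absorb′ m p with p ℕ.≤? m
... | no p≰m = begin
  (m C p) ℕ.* (m ∸ p)    ≡⟨ cong (ℕ._* (m ∸ p)) (k>n⇒nCk≡0 (ℕP.≰⇒> p≰m)) ⟩
  0                      ≡⟨ cong (ℕ._* suc p) (sym (k>n⇒nCk≡0 (ℕP.m<n⇒m<1+n (ℕP.≰⇒> p≰m)))) ⟩
  (m C suc p) ℕ.* suc p  ∎
  where open ≡-Reasoning
... | yes p≤m = sym (ℕP.+-cancelˡ-≡ ((m C p) ℕ.* suc p) _ _ (begin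
  (m C p) ℕ.* suc p ℕ.+ (m C suc p) ℕ.* suc p  ≡⟨ sym (ℕP.*-distribʳ-+ (suc p) (m C p) (m C suc p)) ⟩
  ((m C p) ℕ.+ (m C suc p)) ℕ.* suc p          ≡⟨ cong (ℕ._* suc p) (nCk+nC[k+1]≡[n+1]C[k+1] m p) ⟩
  (suc m C suc p) ℕ.* suc p                    ≡⟨ C-absorb m p ⟩
  suc m ℕ.* (m C p)                            ≡⟨ cong (λ z → suc z ℕ.* (m C p)) (sym (ℕP.m+[n∸m]≡n p≤m)) ⟩
  suc (p ℕ.+ (m ∸ p)) ℕ.* (m C p)              ≡⟨ distrib p (m ∸ p) (m C p) ⟩
  (m C p) ℕ.* suc p ℕ.+ (m C p) ℕ.* (m ∸ p)    ∎))
  where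
  open ≡-Reasoning
  distrib : ∀ p d b → suc (p ℕ.+ d) ℕ.* b ≡ b ℕ.* suc p ℕ.+ b ℕ.* d
  distrib = ℕ-Ring.solve-∀

C-trinomial : ∀ m n u → ((m ℕ.+ n) C (n ℕ.+ u)) ℕ.* ((n ℕ.+ u) C n) ≡ ((m ℕ.+ n) C n) ℕ.* (m C u)
C-trinomial m n u with u ℕ.≤? m
... | no u≰m = begin
  ((m ℕ.+ n) C (n ℕ.+ u)) ℕ.* ((n ℕ.+ u) C n)  ≡⟨ cong (ℕ._* ((n ℕ.+ u) C n)) (k>n⇒nCk≡0 m+n<n+u) ⟩
  0                                            ≡⟨ sym (ℕP.*-zeroʳ ((m ℕ.+ n) C n)) ⟩
  ((m ℕ.+ n) C n) ℕ.* 0                        ≡⟨ cong (((m ℕ.+ n) C n) ℕ.*_) (sym (k>n⇒nCk≡0 (ℕP.≰⇒> u≰m))) ⟩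
  ((m ℕ.+ n) C n) ℕ.* (m C u)                  ∎
  where
  open ≡-Reasoning
  m+n<n+u : m ℕ.+ n < n ℕ.+ u
  m+n<n+u = subst (_< n ℕ.+ u) (ℕP.+-comm n m) (ℕP.+-monoʳ-< n (ℕP.≰⇒> u≰m))
... | yes u≤m with ℕP.m≤n⇒∃[o]m+o≡n u≤m
... | d , refl = ℕP.*-cancelʳ-≡ _ _ (n ! ℕ.* (u ! ℕ.* d !)) {{ℕP.m*n≢0 _ _ {{n ℕP.!≢0}} {{u ℕP.!* d !≢0}}}} (begin
  (M C (n ℕ.+ u)) ℕ.* ((n ℕ.+ u) C n) ℕ.* (n ! ℕ.* (u ! ℕ.* d !))
    ≡⟨ regroupˡ (M C (n ℕ.+ u)) ((n ℕ.+ u) C n) (n !) (u !) (d !) ⟩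
  (M C (n ℕ.+ u)) ℕ.* (((n ℕ.+ u) C n) ℕ.* (n ! ℕ.* u !) ℕ.* d !)
    ≡⟨ cong (λ z → (M C (n ℕ.+ u)) ℕ.* (z ℕ.* d !)) (C-factorial n u (n ℕ.+ u) refl) ⟩
  (M C (n ℕ.+ u)) ℕ.* ((n ℕ.+ u) ! ℕ.* d !)
    ≡⟨ C-factorial (n ℕ.+ u) d M (sum₁ n u d) ⟩
  M !
    ≡⟨ sym (C-factorial n (u ℕ.+ d) M (sum₂ n u d)) ⟩
  (M C n) ℕ.* (n ! ℕ.* (u ℕ.+ d) !)
    ≡⟨ cong (λ z → (M C n) ℕ.* (n ! ℕ.* z)) (sym (C-factorial u d (u ℕ.+ d) refl)) ⟩
  (M C n) ℕ.* (n ! ℕ.* (((u ℕ.+ d) C u) ℕ.* (u ! ℕ.* d !)))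
    ≡⟨ regroupʳ (M C n) (n !) ((u ℕ.+ d) C u) (u !) (d !) ⟩
  (M C n) ℕ.* ((u ℕ.+ d) C u) ℕ.* (n ! ℕ.* (u ! ℕ.* d !)) ∎)
  where
  open ≡-Reasoning
  M = u ℕ.+ d ℕ.+ n
  regroupˡ : ∀ x y a b c → x ℕ.* y ℕ.* (a ℕ.* (b ℕ.* c)) ≡ x ℕ.* (y ℕ.* (a ℕ.* b) ℕ.* c)
  regroupˡ = ℕ-Ring.solve-∀
  regroupʳ : ∀ x a y b c → x ℕ.* (a ℕ.* (y ℕ.* (b ℕ.* c))) ≡ x ℕ.* y ℕ.* (a ℕ.* (b ℕ.* c))
  regroupʳ = ℕ-Ring.solve-∀
  sum₁ : ∀ n u d → n ℕ.+ u ℕ.+ d ≡ u ℕ.+ d ℕ.+ n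
  sum₁ = ℕ-Ring.solve-∀
  sum₂ : ∀ n u d → n ℕ.+ (u ℕ.+ d) ≡ u ℕ.+ d ℕ.+ n
  sum₂ = ℕ-Ring.solve-∀

Σ-pascal : ∀ k (a : ℕ → ℚ) → Σ≤ (suc k) (λ t → binom (suc k) t * a t)
         ≡ Σ≤ k (λ t → binom k t * a t) + Σ≤ k (λ t → binom k t * a (suc t))
Σ-pascal k a = begin
  Σ≤ (suc k) (λ t → binom (suc k) t * a t)     ≡⟨ Σ≤-first k (λ t → binom (suc k) t * a t) ⟩
  a₀ + Σ≤ k (λ t → binom (suc k) (suc t) * a (suc t))
    ≡⟨ cong (λ z → a₀ + z) (Σ≤-cong k (λ t → trans (cong (_* a (suc t)) (binom-pascal k t)) (*-distribʳ-+ (a (suc t)) (binom k t) (binom k (suc t))))) ⟩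
  a₀ + Σ≤ k (λ t → binom k t * a (suc t) + binom k (suc t) * a (suc t))
    ≡⟨ cong (λ z → a₀ + z) (Σ≤-+ k _ _) ⟩
  a₀ + (S₁ + S₂)                               ≡⟨ solve 3 (λ x y z → x :+ (y :+ z) := (x :+ z) :+ y) refl a₀ S₁ S₂ ⟩
  (a₀ + S₂) + S₁
    ≡⟨ cong (λ z → z * a 0 + S₂ + S₁) (trans (binom-zero (suc k)) (sym (binom-zero k))) ⟩
  (binom k 0 * a 0 + S₂) + S₁                  ≡⟨ cong (_+ S₁) (sym (Σ≤-first k (λ t → binom k t * a t))) ⟩
  Σ≤ (suc k) (λ t → binom k t * a t) + S₁
    ≡⟨ cong (λ z → Σ≤ k (λ t → binom k t * a t) + z + S₁) (trans (cong (_* a (suc k)) (binom-vanish k (suc k) (ℕP.n<1+n k))) (*-zeroˡ (a (suc k)))) ⟩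
  Σ≤ k (λ t → binom k t * a t) + 0ℚ + S₁  ≡⟨ cong (_+ S₁) (+-identityʳ (Σ≤ k (λ t → binom k t * a t))) ⟩
  Σ≤ k (λ t → binom k t * a t) + S₁       ∎
  where
  open ≡-Reasoning
  a₀ = binom (suc k) 0 * a 0
  S₁ = Σ≤ k (λ t → binom k t * a (suc t))
  S₂ = Σ≤ k (λ t → binom k (suc t) * a (suc t))

vandermonde : ∀ k p m → binom (m ℕ.+ k) (p ℕ.+ k) ≡ Σ≤ k (λ t → binom k t * binom m (p ℕ.+ t))
vandermonde zero    p m = begin
  binom (m ℕ.+ 0) (p ℕ.+ 0)      ≡⟨ cong₂ binom (ℕP.+-identityʳ m) (ℕP.+-identityʳ p) ⟩
  binom m p                      ≡⟨ sym (*-identityˡ (binom m p)) ⟩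
  1ℚ * binom m p                 ≡⟨ cong₂ (λ a z → a * binom m z) (sym (binom-zero 0)) (sym (ℕP.+-identityʳ p)) ⟩
  binom 0 0 * binom m (p ℕ.+ 0)  ∎
  where open ≡-Reasoning
vandermonde (suc k) p m = begin
  binom (m ℕ.+ suc k) (p ℕ.+ suc k)      ≡⟨ cong₂ binom (ℕP.+-suc m k) (ℕP.+-suc p k) ⟩
  binom (suc (m ℕ.+ k)) (suc (p ℕ.+ k))  ≡⟨ binom-pascal (m ℕ.+ k) (p ℕ.+ k) ⟩
  binom (m ℕ.+ k) (p ℕ.+ k) + binom (m ℕ.+ k) (suc p ℕ.+ k)
    ≡⟨ cong₂ _+_ (vandermonde k p m) (vandermonde k (suc p) m) ⟩
  Σ≤ k (λ t → binom k t * binom m (p ℕ.+ t)) + Σ≤ k (λ t → binom k t * binom m (suc p ℕ.+ t))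
    ≡⟨ cong (Σ≤ k (λ t → binom k t * binom m (p ℕ.+ t)) +_) (Σ≤-cong k (λ t → cong (λ z → binom k t * binom m z) (sym (ℕP.+-suc p t)))) ⟩
  Σ≤ k (λ t → binom k t * binom m (p ℕ.+ t)) + Σ≤ k (λ t → binom k t * binom m (p ℕ.+ suc t))
    ≡⟨ sym (Σ-pascal k (λ t → binom m (p ℕ.+ t))) ⟩
  Σ≤ (suc k) (λ t → binom (suc k) t * binom m (p ℕ.+ t)) ∎
  where open ≡-Reasoning

-- Formal power series over ℚ, as coefficient sequences

Series : Set
Series = ℕ → ℚ

infix 4 _≈_
_≈_ : Series → Series → Set
f ≈ g = ∀ i → f i ≡ g i

≈-refl : ∀ {f} → f ≈ f
≈-refl _ = refl

≈-sym : ∀ {f g} → f ≈ g → g ≈ f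
≈-sym f≈g i = sym (f≈g i)

≈-trans : ∀ {f g h} → f ≈ g → g ≈ h → f ≈ h
≈-trans f≈g g≈h i = trans (f≈g i) (g≈h i)

Series-setoid : Setoid _ _
Series-setoid = record
  { Carrier       = Series
  ; _≈_           = _≈_
  ; isEquivalence = record { refl = ≈-refl ; sym = ≈-sym ; trans = ≈-trans }
  }

module ≈-Reasoning = SetoidReasoning Series-setoid

infixl 6 _⊕_
infixl 7 _·_ _⋆_

_⊕_ : Series → Series → Series
(f ⊕ g) i = f i + g i

_·_ : ℚ → Series → Series
(c · f) i = c * f i

δ : Series
δ zero    = 1ℚ
δ (suc _) = 0ℚ

_⋆_ : Series → Series → Series
(f ⋆ g) j = Σ≤ j (λ i → f i * g (j ∸ i))

X : Series → Series
X f zero    = 0ℚ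
X f (suc i) = f i

X^ : ℕ → Series → Series
X^ zero    f = f
X^ (suc u) f = X (X^ u f)

⊕-cong : ∀ {f f′ g g′} → f ≈ f′ → g ≈ g′ → f ⊕ g ≈ f′ ⊕ g′
⊕-cong f≈f′ g≈g′ i = cong₂ _+_ (f≈f′ i) (g≈g′ i)

·-cong : ∀ c {f g} → f ≈ g → c · f ≈ c · g
·-cong c f≈g i = cong (c *_) (f≈g i)

⋆-cong : ∀ {f f′ g g′} → f ≈ f′ → g ≈ g′ → f ⋆ g ≈ f′ ⋆ g′
⋆-cong f≈f′ g≈g′ j = Σ≤-cong j (λ i → cong₂ _*_ (f≈f′ i) (g≈g′ (j ∸ i)))

⋆-congˡ : ∀ {f f′} g → f ≈ f′ → f ⋆ g ≈ f′ ⋆ g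
⋆-congˡ g f≈f′ = ⋆-cong f≈f′ (≈-refl {g})

⋆-congʳ : ∀ f {g g′} → g ≈ g′ → f ⋆ g ≈ f ⋆ g′
⋆-congʳ f g≈g′ = ⋆-cong (≈-refl {f}) g≈g′

X-cong : ∀ {f g} → f ≈ g → X f ≈ X g
X-cong f≈g zero    = refl
X-cong f≈g (suc i) = f≈g i

X^-cong : ∀ u {f g} → f ≈ g → X^ u f ≈ X^ u g
X^-cong zero    f≈g = f≈g
X^-cong (suc u) f≈g = X-cong (X^-cong u f≈g)

⋆-comm : ∀ f g → f ⋆ g ≈ g ⋆ f
⋆-comm f g j = trans (Σ≤-reverse j (λ i → f i * g (j ∸ i)))
  (Σ≤-cong-≤ j (λ i i≤j → trans (cong (λ z → f (j ∸ i) * g z) (ℕP.m∸[m∸n]≡n i≤j)) (*-comm (f (j ∸ i)) (g i))))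

⋆-suc : ∀ f g j → (f ⋆ g) (suc j) ≡ f 0 * g (suc j) + ((f ∘ suc) ⋆ g) j
⋆-suc f g j = Σ≤-first j (λ i → f i * g (suc j ∸ i))

⋆-⊕ˡ : ∀ f f′ g → (f ⊕ f′) ⋆ g ≈ f ⋆ g ⊕ f′ ⋆ g
⋆-⊕ˡ f f′ g j = trans (Σ≤-cong j (λ i → *-distribʳ-+ (g (j ∸ i)) (f i) (f′ i)))
  (Σ≤-+ j (λ i → f i * g (j ∸ i)) (λ i → f′ i * g (j ∸ i)))

⋆-·ˡ : ∀ c f g → (c · f) ⋆ g ≈ c · (f ⋆ g)
⋆-·ˡ c f g j = trans (Σ≤-cong j (λ i → *-assoc c (f i) (g (j ∸ i)))) (sym (Σ≤-*ˡ j c (λ i → f i * g (j ∸ i))))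

⋆-assoc : ∀ f g h → (f ⋆ g) ⋆ h ≈ f ⋆ (g ⋆ h)
⋆-assoc f g h zero    = *-assoc (f 0) (g 0) (h 0)
⋆-assoc f g h (suc j) = begin
  ((f ⋆ g) ⋆ h) (suc j)                            ≡⟨ ⋆-suc (f ⋆ g) h j ⟩
  f 0 * g 0 * h (suc j) + (((f ⋆ g) ∘ suc) ⋆ h) j  ≡⟨ cong (f 0 * g 0 * h (suc j) +_) (⋆-congˡ h (⋆-suc f g) j) ⟩
  f 0 * g 0 * h (suc j) + ((f 0 · (g ∘ suc) ⊕ (f ∘ suc) ⋆ g) ⋆ h) j
    ≡⟨ cong (f 0 * g 0 * h (suc j) +_) (⋆-⊕ˡ (f 0 · (g ∘ suc)) ((f ∘ suc) ⋆ g) h j) ⟩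
  f 0 * g 0 * h (suc j) + (((f 0 · (g ∘ suc)) ⋆ h) j + (((f ∘ suc) ⋆ g) ⋆ h) j)
    ≡⟨ cong₂ (λ a b → f 0 * g 0 * h (suc j) + (a + b)) (⋆-·ˡ (f 0) (g ∘ suc) h j) (⋆-assoc (f ∘ suc) g h j) ⟩
  f 0 * g 0 * h (suc j) + (f 0 * ((g ∘ suc) ⋆ h) j + ((f ∘ suc) ⋆ (g ⋆ h)) j)
    ≡⟨ solve 5 (λ a b c d e → a :* b :* c :+ (a :* d :+ e) := a :* (b :* c :+ d) :+ e) refl
         (f 0) (g 0) (h (suc j)) (((g ∘ suc) ⋆ h) j) (((f ∘ suc) ⋆ (g ⋆ h)) j) ⟩
  f 0 * (g 0 * h (suc j) + ((g ∘ suc) ⋆ h) j) + ((f ∘ suc) ⋆ (g ⋆ h)) j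
    ≡⟨ cong (λ z → f 0 * z + ((f ∘ suc) ⋆ (g ⋆ h)) j) (sym (⋆-suc g h j)) ⟩
  f 0 * (g ⋆ h) (suc j) + ((f ∘ suc) ⋆ (g ⋆ h)) j  ≡⟨ sym (⋆-suc f (g ⋆ h) j) ⟩
  (f ⋆ (g ⋆ h)) (suc j)                            ∎
  where open ≡-Reasoning

⋆-⊕ʳ : ∀ f g g′ → f ⋆ (g ⊕ g′) ≈ f ⋆ g ⊕ f ⋆ g′
⋆-⊕ʳ f g g′ j = trans (⋆-comm f (g ⊕ g′) j) (trans (⋆-⊕ˡ g g′ f j) (cong₂ _+_ (⋆-comm g f j) (⋆-comm g′ f j)))

⋆-δˡ : ∀ g → δ ⋆ g ≈ g
⋆-δˡ g zero    = *-identityˡ (g 0)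
⋆-δˡ g (suc j) = begin
  (δ ⋆ g) (suc j)                     ≡⟨ ⋆-suc δ g j ⟩
  1ℚ * g (suc j) + ((δ ∘ suc) ⋆ g) j  ≡⟨ cong₂ _+_ (*-identityˡ (g (suc j))) (Σ≤-zero j _ (λ i _ → *-zeroˡ (g (j ∸ i)))) ⟩
  g (suc j) + 0ℚ                      ≡⟨ +-identityʳ (g (suc j)) ⟩
  g (suc j)                           ∎
  where open ≡-Reasoning

⋆-δʳ : ∀ g → g ⋆ δ ≈ g
⋆-δʳ g = ≈-trans (⋆-comm g δ) (⋆-δˡ g)

⋆-Xˡ : ∀ f g → X f ⋆ g ≈ X (f ⋆ g)
⋆-Xˡ f g zero    = *-zeroˡ (g 0)
⋆-Xˡ f g (suc j) = trans (⋆-suc (X f) g j) (trans (cong (_+ (f ⋆ g) j) (*-zeroˡ (g (suc j)))) (+-identityˡ ((f ⋆ g) j)))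

⋆-Xʳ : ∀ f g → f ⋆ X g ≈ X (f ⋆ g)
⋆-Xʳ f g = ≈-trans (⋆-comm f (X g)) (≈-trans (⋆-Xˡ g f) (X-cong (⋆-comm g f)))

⋆-X^ʳ : ∀ u f g → f ⋆ X^ u g ≈ X^ u (f ⋆ g)
⋆-X^ʳ zero    f g = ≈-refl
⋆-X^ʳ (suc u) f g = ≈-trans (⋆-Xʳ f (X^ u g)) (X-cong (⋆-X^ʳ u f g))

X^-+ : ∀ a b f → X^ (a ℕ.+ b) f ≈ X^ a (X^ b f)
X^-+ zero    b f = ≈-refl
X^-+ (suc a) b f = X-cong (X^-+ a b f)

X^-X : ∀ t g → X^ t (X g) ≈ X (X^ t g)
X^-X zero    g = ≈-refl
X^-X (suc t) g = X-cong (X^-X t g)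

X^-⊕ : ∀ u f g → X^ u (f ⊕ g) ≈ X^ u f ⊕ X^ u g
X^-⊕ zero    f g = ≈-refl
X^-⊕ (suc u) f g = ≈-trans (X-cong (X^-⊕ u f g)) lemma
  where
  lemma : X (X^ u f ⊕ X^ u g) ≈ X (X^ u f) ⊕ X (X^ u g)
  lemma zero    = sym (+-identityʳ 0ℚ)
  lemma (suc i) = refl

X^-· : ∀ u c f → X^ u (c · f) ≈ c · X^ u f
X^-· zero    c f = ≈-refl
X^-· (suc u) c f = ≈-trans (X-cong (X^-· u c f)) lemma
  where
  lemma : X (c · X^ u f) ≈ c · X (X^ u f)
  lemma zero    = sym (*-zeroʳ c)
  lemma (suc i) = refl

X^-above : ∀ u f j → X^ u f (u ℕ.+ j) ≡ f j
X^-above zero    f j = refl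
X^-above (suc u) f j = X^-above u f j

X^-below : ∀ u f j → j < u → X^ u f j ≡ 0ℚ
X^-below (suc u) f zero    _         = refl
X^-below (suc u) f (suc j) (s≤s j<u) = X^-below u f j j<u

X^δ-diagonal : ∀ j → X^ j δ j ≡ 1ℚ
X^δ-diagonal zero    = refl
X^δ-diagonal (suc j) = X^δ-diagonal j

X^δ-off : ∀ s j → s < j → X^ s δ j ≡ 0ℚ
X^δ-off zero    (suc j) _         = refl
X^δ-off (suc s) (suc j) (s≤s s<j) = X^δ-off s j s<j

Σ-monomials : ∀ k (a : ℕ → ℚ) j → j ≤ k → Σ≤ k (λ s → a s * X^ s δ j) ≡ a j
Σ-monomials zero    a zero z≤n = *-identityʳ (a 0)
Σ-monomials (suc k) a j j≤1+k with ℕP.m≤n⇒m<n∨m≡n j≤1+k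
... | inj₁ (s≤s j≤k) = begin
  Σ≤ k (λ s → a s * X^ s δ j) + a (suc k) * X^ (suc k) δ j
    ≡⟨ cong₂ _+_ (Σ-monomials k a j j≤k) (trans (cong (a (suc k) *_) (X^-below (suc k) δ j (s≤s j≤k))) (*-zeroʳ (a (suc k)))) ⟩
  a j + 0ℚ  ≡⟨ +-identityʳ (a j) ⟩
  a j       ∎
  where open ≡-Reasoning
... | inj₂ refl = begin
  Σ≤ k (λ s → a s * X^ s δ (suc k)) + a (suc k) * X^ (suc k) δ (suc k)
    ≡⟨ cong₂ _+_ (Σ≤-zero k _ lower) (cong (a (suc k) *_) (X^δ-diagonal (suc k))) ⟩
  0ℚ + a (suc k) * 1ℚ  ≡⟨ trans (+-identityˡ _) (*-identityʳ (a (suc k))) ⟩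
  a (suc k)            ∎
  where
  open ≡-Reasoning
  lower : ∀ s → s ≤ k → a s * X^ s δ (suc k) ≡ 0ℚ
  lower s s≤k = trans (cong (a s *_) (X^δ-off s (suc k) (s≤s s≤k))) (*-zeroʳ (a s))

ΣS : ℕ → (ℕ → Series) → Series
ΣS k F i = Σ≤ k (λ t → F t i)

ΣS-cong : ∀ k {F G : ℕ → Series} → (∀ t → t ≤ k → F t ≈ G t) → ΣS k F ≈ ΣS k G
ΣS-cong k F≈G i = Σ≤-cong-≤ k (λ t t≤k → F≈G t t≤k i)

ΣS-⋆ : ∀ k F g → ΣS k F ⋆ g ≈ ΣS k (λ t → F t ⋆ g)
ΣS-⋆ k F g j = trans (Σ≤-cong j (λ i → Σ≤-*ʳ k (λ t → F t i) (g (j ∸ i))))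
  (Σ≤-swap j k (λ i t → F t i * g (j ∸ i)))

ΣS-X^ : ∀ u k F → X^ u (ΣS k F) ≈ ΣS k (λ t → X^ u (F t))
ΣS-X^ zero    k F = ≈-refl
ΣS-X^ (suc u) k F = ≈-trans (X-cong (ΣS-X^ u k F)) lemma
  where
  lemma : X (ΣS k (λ t → X^ u (F t))) ≈ ΣS k (λ t → X (X^ u (F t)))
  lemma zero    = sym (Σ≤-zero k _ (λ _ _ → refl))
  lemma (suc i) = refl

-- The series (1-x)^N and (1-x)^-(r+1)

[1-x]^ : ℕ → Series
[1-x]^ N i = sgn i * binom N i

[1-x]^0 : [1-x]^ 0 ≈ δ
[1-x]^0 zero    = trans (cong (1ℚ *_) (binom-zero 0)) (*-identityˡ 1ℚ)
[1-x]^0 (suc i) = trans (cong (sgn (suc i) *_) (binom-vanish 0 (suc i) (s≤s z≤n))) (*-zeroʳ (sgn (suc i)))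

[1-x]⋆ : ∀ g → [1-x]^ 1 ⋆ g ≈ g ⊕ (- 1ℚ) · X g
[1-x]⋆ g = ≈-trans (⋆-congˡ g one-minus-x)
  (≈-trans (⋆-⊕ˡ δ ((- 1ℚ) · X δ) g)
  (⊕-cong (⋆-δˡ g) (≈-trans (⋆-·ˡ (- 1ℚ) (X δ) g) (·-cong (- 1ℚ) (≈-trans (⋆-Xˡ δ g) (X-cong (⋆-δˡ g)))))))
  where
  one-minus-x : [1-x]^ 1 ≈ δ ⊕ (- 1ℚ) · X δ
  one-minus-x zero          = cong (1ℚ *_) (binom-zero 1)
  one-minus-x (suc zero)    = cong (- 1ℚ *_) (binom-diagonal 1)
  one-minus-x (suc (suc i)) = trans (cong (sgn (suc (suc i)) *_) (binom-vanish 1 (suc (suc i)) (s≤s (s≤s z≤n))))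
                                    (*-zeroʳ (sgn (suc (suc i))))

[1-x]^-pascal : ∀ N → [1-x]^ (suc N) ≈ [1-x]^ N ⊕ (- 1ℚ) · X ([1-x]^ N)
[1-x]^-pascal N zero    = begin
  1ℚ * binom (suc N) 0      ≡⟨ cong (1ℚ *_) (trans (binom-zero (suc N)) (sym (binom-zero N))) ⟩
  [1-x]^ N 0                ≡⟨ sym (+-identityʳ ([1-x]^ N 0)) ⟩
  [1-x]^ N 0 + 0ℚ           ≡⟨ cong ([1-x]^ N 0 +_) (sym (*-zeroʳ (- 1ℚ))) ⟩
  [1-x]^ N 0 + (- 1ℚ) * 0ℚ  ∎
  where open ≡-Reasoning
[1-x]^-pascal N (suc i) = trans (cong (- sgn i *_) (binom-pascal N i))
  (solve 3 (λ s a b → (:- s) :* (a :+ b) := (:- s) :* b :+ (:- con 1ℚ) :* (s :* a)) refl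
     (sgn i) (binom N i) (binom N (suc i)))

[1-x]^-suc : ∀ N → [1-x]^ (suc N) ≈ [1-x]^ 1 ⋆ [1-x]^ N
[1-x]^-suc N = ≈-trans ([1-x]^-pascal N) (≈-sym ([1-x]⋆ ([1-x]^ N)))

[1-x]^-+ : ∀ a b → [1-x]^ (a ℕ.+ b) ≈ [1-x]^ a ⋆ [1-x]^ b
[1-x]^-+ zero    b = ≈-trans (≈-sym (⋆-δˡ ([1-x]^ b))) (⋆-congˡ ([1-x]^ b) (≈-sym [1-x]^0))
[1-x]^-+ (suc a) b =
  ≈-trans ([1-x]^-suc (a ℕ.+ b))
  (≈-trans (⋆-congʳ ([1-x]^ 1) ([1-x]^-+ a b))
  (≈-trans (≈-sym (⋆-assoc ([1-x]^ 1) ([1-x]^ a) ([1-x]^ b)))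
  (⋆-congˡ ([1-x]^ b) (≈-sym ([1-x]^-suc a)))))

inv[1-x]^ : ℕ → Series
inv[1-x]^ r i = binom (i ℕ.+ r) r

[1-x]^-inverse : ∀ r → [1-x]^ (suc r) ⋆ inv[1-x]^ r ≈ δ
[1-x]^-inverse zero    = ≈-trans ([1-x]⋆ (inv[1-x]^ 0)) telescope
  where
  telescope : inv[1-x]^ 0 ⊕ (- 1ℚ) · X (inv[1-x]^ 0) ≈ δ
  telescope zero    = cong (λ z → z + (- 1ℚ) * 0ℚ) (binom-zero 0)
  telescope (suc i) = trans (cong₂ (λ a b → a + (- 1ℚ) * b) (binom-zero (suc i ℕ.+ 0)) (binom-zero (i ℕ.+ 0)))
                            (+-inverseʳ 1ℚ)
[1-x]^-inverse (suc r) =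
  ≈-trans (⋆-congˡ (inv[1-x]^ (suc r)) (≈-trans ([1-x]^-suc (suc r)) (⋆-comm ([1-x]^ 1) ([1-x]^ (suc r)))))
  (≈-trans (⋆-assoc ([1-x]^ (suc r)) ([1-x]^ 1) (inv[1-x]^ (suc r)))
  (≈-trans (⋆-congʳ ([1-x]^ (suc r)) (≈-trans ([1-x]⋆ (inv[1-x]^ (suc r))) lower-order))
  ([1-x]^-inverse r)))
  where
  lower-order : inv[1-x]^ (suc r) ⊕ (- 1ℚ) · X (inv[1-x]^ (suc r)) ≈ inv[1-x]^ r
  lower-order zero = begin
    binom (suc r) (suc r) + (- 1ℚ) * 0ℚ  ≡⟨ cong₂ _+_ (binom-diagonal (suc r)) (*-zeroʳ (- 1ℚ)) ⟩
    1ℚ + 0ℚ                              ≡⟨ sym (binom-diagonal r) ⟩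
    binom r r                            ∎
    where open ≡-Reasoning
  lower-order (suc i) = begin
    binom (suc i ℕ.+ suc r) (suc r) + (- 1ℚ) * binom (i ℕ.+ suc r) (suc r)
      ≡⟨ cong (_+ (- 1ℚ) * binom (i ℕ.+ suc r) (suc r)) (binom-pascal (i ℕ.+ suc r) r) ⟩
    binom (i ℕ.+ suc r) r + binom (i ℕ.+ suc r) (suc r) + (- 1ℚ) * binom (i ℕ.+ suc r) (suc r)
      ≡⟨ solve 2 (λ a b → a :+ b :+ (:- con 1ℚ) :* b := a) refl (binom (i ℕ.+ suc r) r) (binom (i ℕ.+ suc r) (suc r)) ⟩
    binom (i ℕ.+ suc r) r
      ≡⟨ cong (λ z → binom z r) (ℕP.+-suc i r) ⟩
    binom (suc i ℕ.+ r) r ∎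
    where open ≡-Reasoning

-- Newton's forward-difference form of a Bernstein-type sum:
--   Σ_t C(k,t) f(t) x^t (1-x)^(k-t)  =  Σ_s C(k,s) (Δ^s f)(0) x^s

Δ : Series → Series
Δ f t = f (suc t) + - f t

Δ^ : ℕ → Series → Series
Δ^ zero    f = f
Δ^ (suc s) f = Δ^ s (Δ f)

bern : ℕ → ℕ → Series
bern k t = X^ t ([1-x]^ (k ∸ t))

bernstein : ℕ → Series → Series
bernstein k f i = Σ≤ k (λ t → binom k t * (f t * bern k t i))

newton : ℕ → Series → Series
newton k f i = Σ≤ k (λ s → binom k s * (Δ^ s f 0 * X^ s δ i))

bern-suc : ∀ k t → t ≤ k → bern (suc k) t ≈ bern k t ⊕ (- 1ℚ) · X (bern k t)
bern-suc k t t≤k i = begin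
  X^ t ([1-x]^ (suc k ∸ t)) i                            ≡⟨ cong (λ z → X^ t ([1-x]^ z) i) (ℕP.+-∸-assoc 1 t≤k) ⟩
  X^ t ([1-x]^ (suc (k ∸ t))) i                          ≡⟨ X^-cong t ([1-x]^-pascal (k ∸ t)) i ⟩
  X^ t ([1-x]^ (k ∸ t) ⊕ (- 1ℚ) · X ([1-x]^ (k ∸ t))) i  ≡⟨ X^-⊕ t ([1-x]^ (k ∸ t)) ((- 1ℚ) · X ([1-x]^ (k ∸ t))) i ⟩
  bern k t i + X^ t ((- 1ℚ) · X ([1-x]^ (k ∸ t))) i      ≡⟨ cong (bern k t i +_) (X^-· t (- 1ℚ) (X ([1-x]^ (k ∸ t))) i) ⟩
  bern k t i + (- 1ℚ) * X^ t (X ([1-x]^ (k ∸ t))) i      ≡⟨ cong (λ z → bern k t i + (- 1ℚ) * z) (X^-X t ([1-x]^ (k ∸ t)) i) ⟩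
  bern k t i + (- 1ℚ) * X (bern k t) i                   ∎
  where open ≡-Reasoning

bernstein-X : ∀ k g i → Σ≤ k (λ t → binom k t * (g t * X (bern k t) i)) ≡ X (bernstein k g) i
bernstein-X k g zero    = Σ≤-zero k _ (λ t _ → trans (cong (binom k t *_) (*-zeroʳ (g t))) (*-zeroʳ (binom k t)))
bernstein-X k g (suc i) = refl

bernstein-Δ : ∀ k f i → bernstein k (Δ f) i ≡ bernstein k (f ∘ suc) i + (- 1ℚ) * bernstein k f i
bernstein-Δ k f i = begin
  bernstein k (Δ f) i
    ≡⟨ Σ≤-cong k (λ t → solve 4 (λ b a a′ x → b :* ((a′ :+ :- a) :* x) := b :* (a′ :* x) :+ (:- con 1ℚ) :* (b :* (a :* x))) refl
                    (binom k t) (f t) (f (suc t)) (bern k t i)) ⟩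
  Σ≤ k (λ t → binom k t * (f (suc t) * bern k t i) + (- 1ℚ) * (binom k t * (f t * bern k t i)))
    ≡⟨ Σ≤-+ k _ _ ⟩
  bernstein k (f ∘ suc) i + Σ≤ k (λ t → (- 1ℚ) * (binom k t * (f t * bern k t i)))
    ≡⟨ cong (bernstein k (f ∘ suc) i +_) (sym (Σ≤-*ˡ k (- 1ℚ) _)) ⟩
  bernstein k (f ∘ suc) i + (- 1ℚ) * bernstein k f i ∎
  where open ≡-Reasoning

-- Both sides satisfy the recursion  P (k+1) f = P k f + x ⋅ P k (Δ f).
bernstein-suc : ∀ k f → bernstein (suc k) f ≈ bernstein k f ⊕ X (bernstein k (Δ f))
bernstein-suc k f i = begin
  bernstein (suc k) f i
    ≡⟨ Σ-pascal k (λ t → f t * bern (suc k) t i) ⟩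
  Σ≤ k (λ t → binom k t * (f t * bern (suc k) t i)) + W (f ∘ suc)
    ≡⟨ cong (_+ W (f ∘ suc)) (Σ≤-cong-≤ k (λ t t≤k → cong (λ z → binom k t * (f t * z)) (bern-suc k t t≤k i))) ⟩
  Σ≤ k (λ t → binom k t * (f t * (bern k t i + (- 1ℚ) * X (bern k t) i))) + W (f ∘ suc)
    ≡⟨ cong (_+ W (f ∘ suc)) (Σ≤-cong k (λ t → solve 4 (λ b a x y → b :* (a :* (x :+ (:- con 1ℚ) :* y)) := b :* (a :* x) :+ (:- con 1ℚ) :* (b :* (a :* y))) refl
         (binom k t) (f t) (bern k t i) (X (bern k t) i))) ⟩
  Σ≤ k (λ t → binom k t * (f t * bern k t i) + (- 1ℚ) * (binom k t * (f t * X (bern k t) i))) + W (f ∘ suc)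
    ≡⟨ cong (_+ W (f ∘ suc)) (trans (Σ≤-+ k _ _) (cong (bernstein k f i +_) (sym (Σ≤-*ˡ k (- 1ℚ) _)))) ⟩
  bernstein k f i + (- 1ℚ) * W f + W (f ∘ suc)
    ≡⟨ cong₂ (λ x y → bernstein k f i + (- 1ℚ) * x + y) (bernstein-X k f i) (bernstein-X k (f ∘ suc) i) ⟩
  bernstein k f i + (- 1ℚ) * X (bernstein k f) i + X (bernstein k (f ∘ suc)) i
    ≡⟨ +-assoc (bernstein k f i) _ _ ⟩
  bernstein k f i + ((- 1ℚ) * X (bernstein k f) i + X (bernstein k (f ∘ suc)) i)
    ≡⟨ cong (bernstein k f i +_) (difference i) ⟩
  bernstein k f i + X (bernstein k (Δ f)) i ∎
  where
  open ≡-Reasoning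
  W : Series → ℚ
  W g = Σ≤ k (λ t → binom k t * (g t * X (bern k t) i))
  difference : ∀ i → (- 1ℚ) * X (bernstein k f) i + X (bernstein k (f ∘ suc)) i ≡ X (bernstein k (Δ f)) i
  difference zero    = trans (cong (_+ 0ℚ) (*-zeroʳ (- 1ℚ))) (+-identityʳ 0ℚ)
  difference (suc i) = trans (+-comm ((- 1ℚ) * bernstein k f i) (bernstein k (f ∘ suc) i)) (sym (bernstein-Δ k f i))

newton-suc : ∀ k f → newton (suc k) f ≈ newton k f ⊕ X (newton k (Δ f))
newton-suc k f zero    = trans (Σ-pascal k (λ s → Δ^ s f 0 * X^ s δ 0))
  (cong (newton k f 0 +_) (Σ≤-zero k _ (λ t _ → trans (cong (binom k t *_) (*-zeroʳ (Δ^ (suc t) f 0))) (*-zeroʳ (binom k t)))))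
newton-suc k f (suc i) = Σ-pascal k (λ s → Δ^ s f 0 * X^ s δ (suc i))

bernstein≈newton : ∀ k f → bernstein k f ≈ newton k f
bernstein≈newton zero    f i = cong (λ z → binom 0 0 * (f 0 * z)) ([1-x]^0 i)
bernstein≈newton (suc k) f =
  ≈-trans (bernstein-suc k f)
  (≈-trans (⊕-cong (bernstein≈newton k f) (X-cong (bernstein≈newton k (Δ f))))
  (≈-sym (newton-suc k f)))

Δ-cong : ∀ {f g} → f ≈ g → Δ f ≈ Δ g
Δ-cong f≈g t = cong₂ (λ x y → x + - y) (f≈g (suc t)) (f≈g t)

Δ^-cong : ∀ s {f g} → f ≈ g → Δ^ s f ≈ Δ^ s g
Δ^-cong zero    f≈g = f≈g
Δ^-cong (suc s) f≈g = Δ^-cong s (Δ-cong f≈g)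

Δ^-binom : ∀ s n A → s ≤ n → Δ^ s (λ t → binom (A ℕ.+ t) n) ≈ (λ t → binom (A ℕ.+ t) (n ∸ s))
Δ^-binom zero    n       A _         = ≈-refl
Δ^-binom (suc s) (suc n) A (s≤s s≤n) = ≈-trans (Δ^-cong s pascal) (Δ^-binom s n A s≤n)
  where
  pascal : Δ (λ t → binom (A ℕ.+ t) (suc n)) ≈ (λ t → binom (A ℕ.+ t) n)
  pascal t = begin
    binom (A ℕ.+ suc t) (suc n) + - binom (A ℕ.+ t) (suc n)
      ≡⟨ cong (λ z → binom z (suc n) + - binom (A ℕ.+ t) (suc n)) (ℕP.+-suc A t) ⟩
    binom (suc (A ℕ.+ t)) (suc n) + - binom (A ℕ.+ t) (suc n)
      ≡⟨ cong (_+ - binom (A ℕ.+ t) (suc n)) (binom-pascal (A ℕ.+ t) n) ⟩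
    binom (A ℕ.+ t) n + binom (A ℕ.+ t) (suc n) + - binom (A ℕ.+ t) (suc n)
      ≡⟨ solve 2 (λ a b → a :+ b :+ :- b := a) refl (binom (A ℕ.+ t) n) (binom (A ℕ.+ t) (suc n)) ⟩
    binom (A ℕ.+ t) n ∎
    where open ≡-Reasoning

-- The key coefficient identity.  For n = p + k the series
--   G(x) = Σ_m C(m+n, n) C(m+k, n) x^m
-- satisfies  (1-x)^(2n+1) G(x) = Σ_{s ≤ k} C(k,s) C(n+p, p+s) x^(p+s).

X^-inv[1-x]^ : ∀ u n m → X^ u (inv[1-x]^ (n ℕ.+ u)) m ≡ binom (m ℕ.+ n) (n ℕ.+ u)
X^-inv[1-x]^ u n m with u ℕ.≤? m
... | yes u≤m with ℕP.m≤n⇒∃[o]m+o≡n u≤m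
...   | j , refl = trans (X^-above u (inv[1-x]^ (n ℕ.+ u)) j) (cong (λ z → binom z (n ℕ.+ u)) (regroup j n u))
  where
  regroup : ∀ j n u → j ℕ.+ (n ℕ.+ u) ≡ u ℕ.+ j ℕ.+ n
  regroup = ℕ-Ring.solve-∀
X^-inv[1-x]^ u n m | no u≰m = trans (X^-below u (inv[1-x]^ (n ℕ.+ u)) m (ℕP.≰⇒> u≰m))
  (sym (binom-vanish (m ℕ.+ n) (n ℕ.+ u) (subst (_< n ℕ.+ u) (ℕP.+-comm n m) (ℕP.+-monoʳ-< n (ℕP.≰⇒> u≰m)))))

module ColumnIdentity (p k : ℕ) where

  n : ℕ
  n = p ℕ.+ k

  -- the sequence whose differences appear in the answer
  f : Series
  f t = binom (n ℕ.+ p ℕ.+ t) n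

  G : Series
  G m = binom (m ℕ.+ n) n * binom (m ℕ.+ k) n

  E : Series
  E = [1-x]^ (suc (2 ℕ.* n))

  term : ℕ → Series
  term t = (binom k t * f t) · X^ (p ℕ.+ t) (inv[1-x]^ (n ℕ.+ p ℕ.+ t))

  G-expand : G ≈ ΣS k term
  G-expand m = begin
    binom (m ℕ.+ n) n * binom (m ℕ.+ k) (p ℕ.+ k)                     ≡⟨ cong (binom (m ℕ.+ n) n *_) (vandermonde k p m) ⟩
    binom (m ℕ.+ n) n * Σ≤ k (λ t → binom k t * binom m (p ℕ.+ t))    ≡⟨ Σ≤-*ˡ k (binom (m ℕ.+ n) n) _ ⟩
    Σ≤ k (λ t → binom (m ℕ.+ n) n * (binom k t * binom m (p ℕ.+ t)))  ≡⟨ Σ≤-cong k revise ⟩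
    ΣS k term m                                                       ∎
    where
    open ≡-Reasoning
    revise : ∀ t → binom (m ℕ.+ n) n * (binom k t * binom m (p ℕ.+ t)) ≡ term t m
    revise t = begin
      binom (m ℕ.+ n) n * (binom k t * binom m u)
        ≡⟨ solve 3 (λ x y z → x :* (y :* z) := y :* (x :* z)) refl (binom (m ℕ.+ n) n) (binom k t) (binom m u) ⟩
      binom k t * (binom (m ℕ.+ n) n * binom m u)
        ≡⟨ cong (binom k t *_) (binom-* (m ℕ.+ n) n m u) ⟩
      binom k t * ℕ→ℚ (((m ℕ.+ n) C n) ℕ.* (m C u))
        ≡⟨ cong (λ z → binom k t * ℕ→ℚ z) (sym (C-trinomial m n u)) ⟩
      binom k t * ℕ→ℚ (((m ℕ.+ n) C (n ℕ.+ u)) ℕ.* ((n ℕ.+ u) C n))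
        ≡⟨ cong (binom k t *_) (sym (binom-* (m ℕ.+ n) (n ℕ.+ u) (n ℕ.+ u) n)) ⟩
      binom k t * (binom (m ℕ.+ n) (n ℕ.+ u) * binom (n ℕ.+ u) n)
        ≡⟨ solve 3 (λ x y z → x :* (y :* z) := (x :* z) :* y) refl (binom k t) (binom (m ℕ.+ n) (n ℕ.+ u)) (binom (n ℕ.+ u) n) ⟩
      binom k t * binom (n ℕ.+ u) n * binom (m ℕ.+ n) (n ℕ.+ u)
        ≡⟨ cong₂ (λ a b → binom k t * binom a n * b) (sym (ℕP.+-assoc n p t)) (sym (X^-inv[1-x]^ u n m)) ⟩
      binom k t * f t * X^ u (inv[1-x]^ (n ℕ.+ u)) m
        ≡⟨ cong (λ z → binom k t * f t * X^ u (inv[1-x]^ z) m) (sym (ℕP.+-assoc n p t)) ⟩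
      term t m ∎
      where u = p ℕ.+ t

  exponent-split : ∀ t → t ≤ k → suc (2 ℕ.* n) ≡ (k ∸ t) ℕ.+ suc (n ℕ.+ p ℕ.+ t)
  exponent-split t t≤k with ℕP.m≤n⇒∃[o]m+o≡n t≤k
  ... | d , refl = begin
    suc (2 ℕ.* (p ℕ.+ (t ℕ.+ d)))              ≡⟨ cong suc (regroup p t d) ⟩
    suc (d ℕ.+ (p ℕ.+ (t ℕ.+ d) ℕ.+ p ℕ.+ t))  ≡⟨ sym (ℕP.+-suc d _) ⟩
    d ℕ.+ suc (p ℕ.+ (t ℕ.+ d) ℕ.+ p ℕ.+ t)    ≡⟨ cong (ℕ._+ suc (n ℕ.+ p ℕ.+ t)) (sym (ℕP.m+n∸m≡n t d)) ⟩
    (t ℕ.+ d ∸ t) ℕ.+ suc (n ℕ.+ p ℕ.+ t)      ∎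
    where
    open ≡-Reasoning
    regroup : ∀ p t d → 2 ℕ.* (p ℕ.+ (t ℕ.+ d)) ≡ d ℕ.+ (p ℕ.+ (t ℕ.+ d) ℕ.+ p ℕ.+ t)
    regroup = ℕ-Ring.solve-∀

  cancel-term : ∀ t → t ≤ k →
    E ⋆ X^ (p ℕ.+ t) (inv[1-x]^ (n ℕ.+ p ℕ.+ t)) ≈ X^ (p ℕ.+ t) ([1-x]^ (k ∸ t))
  cancel-term t t≤k =
    ≈-trans (⋆-congˡ (X^ u c) (≈-trans (λ i → cong (λ z → [1-x]^ z i) (exponent-split t t≤k)) ([1-x]^-+ (k ∸ t) (suc r))))
    (≈-trans (⋆-X^ʳ u ([1-x]^ (k ∸ t) ⋆ [1-x]^ (suc r)) c)
    (X^-cong u (≈-trans (⋆-assoc ([1-x]^ (k ∸ t)) ([1-x]^ (suc r)) c)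
               (≈-trans (⋆-congʳ ([1-x]^ (k ∸ t)) ([1-x]^-inverse r)) (⋆-δʳ ([1-x]^ (k ∸ t)))))))
    where
    u = p ℕ.+ t
    r = n ℕ.+ p ℕ.+ t
    c = inv[1-x]^ r

  E⋆G : E ⋆ G ≈ X^ p (bernstein k f)
  E⋆G = begin
    E ⋆ G                                             ≈⟨ ⋆-congʳ E G-expand ⟩
    E ⋆ ΣS k term                                     ≈⟨ ⋆-comm E (ΣS k term) ⟩
    ΣS k term ⋆ E                                     ≈⟨ ΣS-⋆ k term E ⟩
    ΣS k (λ t → term t ⋆ E)                           ≈⟨ ΣS-cong k cancel ⟩
    ΣS k (λ t → X^ p ((binom k t * f t) · bern k t))  ≈⟨ ΣS-X^ p k _ ⟨
    X^ p (ΣS k (λ t → (binom k t * f t) · bern k t))  ≈⟨ X^-cong p regroup ⟨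
    X^ p (bernstein k f)                              ∎
    where
    open ≈-Reasoning
    cancel : ∀ t → t ≤ k → term t ⋆ E ≈ X^ p ((binom k t * f t) · bern k t)
    cancel t t≤k = begin
      term t ⋆ E                                         ≈⟨ ⋆-·ˡ (binom k t * f t) (X^ (p ℕ.+ t) c) E ⟩
      (binom k t * f t) · (X^ (p ℕ.+ t) c ⋆ E)           ≈⟨ ·-cong (binom k t * f t) (⋆-comm (X^ (p ℕ.+ t) c) E) ⟩
      (binom k t * f t) · (E ⋆ X^ (p ℕ.+ t) c)           ≈⟨ ·-cong (binom k t * f t) (cancel-term t t≤k) ⟩
      (binom k t * f t) · X^ (p ℕ.+ t) ([1-x]^ (k ∸ t))  ≈⟨ ·-cong (binom k t * f t) (X^-+ p t ([1-x]^ (k ∸ t))) ⟩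
      (binom k t * f t) · X^ p (bern k t)                ≈⟨ X^-· p (binom k t * f t) (bern k t) ⟨
      X^ p ((binom k t * f t) · bern k t)                ∎
      where c = inv[1-x]^ (n ℕ.+ p ℕ.+ t)
    regroup : bernstein k f ≈ ΣS k (λ t → (binom k t * f t) · bern k t)
    regroup i = Σ≤-cong k (λ t → sym (*-assoc (binom k t) (f t) (bern k t i)))

  coefficient-above : ∀ s → s ≤ k → (E ⋆ G) (p ℕ.+ s) ≡ binom k s * binom (n ℕ.+ p) (p ℕ.+ s)
  coefficient-above s s≤k = begin
    (E ⋆ G) (p ℕ.+ s)               ≡⟨ E⋆G (p ℕ.+ s) ⟩
    X^ p (bernstein k f) (p ℕ.+ s)  ≡⟨ X^-above p (bernstein k f) s ⟩
    bernstein k f s                 ≡⟨ bernstein≈newton k f s ⟩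
    Σ≤ k (λ s′ → binom k s′ * (Δ^ s′ f 0 * X^ s′ δ s))
      ≡⟨ Σ≤-cong k (λ s′ → sym (*-assoc (binom k s′) (Δ^ s′ f 0) (X^ s′ δ s))) ⟩
    Σ≤ k (λ s′ → binom k s′ * Δ^ s′ f 0 * X^ s′ δ s)  ≡⟨ Σ-monomials k (λ s′ → binom k s′ * Δ^ s′ f 0) s s≤k ⟩
    binom k s * Δ^ s f 0                              ≡⟨ cong (binom k s *_) (Δ^-binom s n (n ℕ.+ p) s≤n 0) ⟩
    binom k s * binom (n ℕ.+ p ℕ.+ 0) (n ∸ s)         ≡⟨ cong (λ z → binom k s * binom z (n ∸ s)) (ℕP.+-identityʳ (n ℕ.+ p)) ⟩
    binom k s * binom (n ℕ.+ p) (n ∸ s)               ≡⟨ cong (binom k s *_) (binom-symmetric n∸s≤n+p) ⟩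
    binom k s * binom (n ℕ.+ p) (n ℕ.+ p ∸ (n ∸ s))   ≡⟨ cong (λ z → binom k s * binom (n ℕ.+ p) z) complement ⟩
    binom k s * binom (n ℕ.+ p) (p ℕ.+ s)             ∎
    where
    open ≡-Reasoning
    s≤n : s ≤ n
    s≤n = ℕP.≤-trans s≤k (ℕP.m≤n+m k p)
    n∸s≤n+p : n ∸ s ≤ n ℕ.+ p
    n∸s≤n+p = ℕP.≤-trans (ℕP.m∸n≤m n s) (ℕP.m≤m+n n p)
    complement : n ℕ.+ p ∸ (n ∸ s) ≡ p ℕ.+ s
    complement = begin
      n ℕ.+ p ∸ (n ∸ s)  ≡⟨ ℕP.+-∸-comm p (ℕP.m∸n≤m n s) ⟩
      n ∸ (n ∸ s) ℕ.+ p  ≡⟨ cong (ℕ._+ p) (ℕP.m∸[m∸n]≡n s≤n) ⟩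
      s ℕ.+ p            ≡⟨ ℕP.+-comm s p ⟩
      p ℕ.+ s            ∎

  coefficient-below : ∀ j → j < p → (E ⋆ G) j ≡ 0ℚ
  coefficient-below j j<p = trans (E⋆G j) (X^-below p (bernstein k f) j j<p)

-- Evaluating the polynomial U_n⁻¹ x^p = (x)_p [x+1]_(n-p) at natural numbers

eval : Poly → ℚ → ℚ
eval []      x = 0ℚ
eval (a ∷ P) x = a + x * eval P x

eval-padd : ∀ P Q x → eval (padd P Q) x ≡ eval P x + eval Q x
eval-padd []      Q       x = sym (+-identityˡ (eval Q x))
eval-padd (a ∷ P) []      x = sym (+-identityʳ (a + x * eval P x))
eval-padd (a ∷ P) (b ∷ Q) x = trans (cong (λ z → (a + b) + x * z) (eval-padd P Q x))
  (solve 5 (λ a b x u v → (a :+ b) :+ x :* (u :+ v) := (a :+ x :* u) :+ (b :+ x :* v)) refl a b x (eval P x) (eval Q x))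

eval-pscale : ∀ c P x → eval (pscale c P) x ≡ c * eval P x
eval-pscale c []      x = sym (*-zeroʳ c)
eval-pscale c (a ∷ P) x = trans (cong (λ z → c * a + x * z) (eval-pscale c P x))
  (solve 4 (λ c a x u → c :* a :+ x :* (c :* u) := c :* (a :+ x :* u)) refl c a x (eval P x))

eval-pmul : ∀ P Q x → eval (pmul P Q) x ≡ eval P x * eval Q x
eval-pmul []      Q x = sym (*-zeroˡ (eval Q x))
eval-pmul (a ∷ P) Q x = begin
  eval (padd (pscale a Q) (0ℚ ∷ pmul P Q)) x          ≡⟨ eval-padd (pscale a Q) (0ℚ ∷ pmul P Q) x ⟩
  eval (pscale a Q) x + (0ℚ + x * eval (pmul P Q) x)  ≡⟨ cong₂ (λ u v → u + (0ℚ + x * v)) (eval-pscale a Q x) (eval-pmul P Q x) ⟩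
  a * eval Q x + (0ℚ + x * (eval P x * eval Q x))
    ≡⟨ solve 4 (λ a x u v → a :* v :+ (con 0ℚ :+ x :* (u :* v)) := (a :+ x :* u) :* v) refl a x (eval P x) (eval Q x) ⟩
  (a + x * eval P x) * eval Q x                      ∎
  where open ≡-Reasoning

eval-xPlus : ∀ d x → eval (xPlus d) x ≡ x + d
eval-xPlus d x = solve 2 (λ d x → d :+ x :* (con 1ℚ :+ x :* con 0ℚ) := x :+ d) refl d x

length-padd : ∀ P Q b → length P ≤ b → length Q ≤ b → length (padd P Q) ≤ b
length-padd []      Q       b       _         Q≤b       = Q≤b
length-padd (a ∷ P) []      b       P≤b       _         = P≤b
length-padd (a ∷ P) (x ∷ Q) (suc b) (s≤s P≤b) (s≤s Q≤b) = s≤s (length-padd P Q b P≤b Q≤b)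

length-pscale : ∀ c P → length (pscale c P) ≡ length P
length-pscale c []      = refl
length-pscale c (a ∷ P) = cong suc (length-pscale c P)

length-pmul-cons : ∀ P b Q → suc (length (pmul P (b ∷ Q))) ≤ length P ℕ.+ suc (length Q)
length-pmul-cons []      b Q = s≤s z≤n
length-pmul-cons (a ∷ P) b Q = s≤s (length-padd (pscale a (b ∷ Q)) (0ℚ ∷ pmul P (b ∷ Q)) (length P ℕ.+ suc (length Q))
  (subst (_≤ length P ℕ.+ suc (length Q)) (sym (length-pscale a (b ∷ Q))) (ℕP.m≤n+m (suc (length Q)) (length P)))
  (length-pmul-cons P b Q))

length-pmul-[] : ∀ P → length (pmul P []) ≡ length P
length-pmul-[] []      = refl
length-pmul-[] (a ∷ P) = cong suc (length-pmul-[] P)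

length-pmul : ∀ P Q a b → length P ≤ suc a → length Q ≤ suc b → length (pmul P Q) ≤ suc (a ℕ.+ b)
length-pmul P []      a b P≤1+a _ =
  subst (_≤ suc (a ℕ.+ b)) (sym (length-pmul-[] P)) (ℕP.≤-trans P≤1+a (s≤s (ℕP.m≤m+n a b)))
length-pmul P (c ∷ Q) a b P≤1+a Q≤1+b = ℕP.≤-pred (begin
  suc (length (pmul P (c ∷ Q)))  ≤⟨ length-pmul-cons P c Q ⟩
  length P ℕ.+ length (c ∷ Q)    ≤⟨ ℕP.+-mono-≤ P≤1+a Q≤1+b ⟩
  suc a ℕ.+ suc b                ≡⟨ cong suc (ℕP.+-suc a b) ⟩
  suc (suc (a ℕ.+ b))            ∎)
  where open ℕP.≤-Reasoning

length-fallingX : ∀ p → length (fallingX p) ≤ suc p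
length-fallingX zero    = s≤s z≤n
length-fallingX (suc p) = subst (λ z → length (fallingX (suc p)) ≤ suc z) (ℕP.+-comm p 1)
  (length-pmul (fallingX p) (xPlus (- ℕ→ℚ p)) p 1 (length-fallingX p) ℕP.≤-refl)

length-risingX1 : ∀ k → length (risingX1 k) ≤ suc k
length-risingX1 zero    = s≤s z≤n
length-risingX1 (suc k) = subst (λ z → length (risingX1 (suc k)) ≤ suc z) (ℕP.+-comm k 1)
  (length-pmul (risingX1 k) (xPlus (ℕ→ℚ (suc k))) k 1 (length-risingX1 k) ℕP.≤-refl)

U⁻¹x^ : ℕ → ℕ → Poly
U⁻¹x^ N p = pmul (fallingX p) (risingX1 (N ∸ p))

length-U⁻¹x^ : ∀ p k → length (U⁻¹x^ (p ℕ.+ k) p) ≤ suc (p ℕ.+ k)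
length-U⁻¹x^ p k = subst (λ z → length (U⁻¹x^ (p ℕ.+ k) p) ≤ suc (p ℕ.+ z)) (ℕP.m+n∸m≡n p k)
  (length-pmul (fallingX p) (risingX1 (p ℕ.+ k ∸ p)) p (p ℕ.+ k ∸ p) (length-fallingX p) (length-risingX1 (p ℕ.+ k ∸ p)))

pow : ℚ → ℕ → ℚ
pow x zero    = 1ℚ
pow x (suc k) = x * pow x k

ℕ→ℚ-^ : ∀ a k → ℕ→ℚ (a ℕ.^ k) ≡ pow (ℕ→ℚ a) k
ℕ→ℚ-^ a zero    = refl
ℕ→ℚ-^ a (suc k) = trans (ℕ→ℚ-* a (a ℕ.^ k)) (cong (ℕ→ℚ a *_) (ℕ→ℚ-^ a k))

eval-as-sum : ∀ P N x → length P ≤ suc N → Σ≤ N (λ k → coeff P k * pow x k) ≡ eval P x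
eval-as-sum []          N       x _         = Σ≤-zero N _ (λ k _ → *-zeroˡ (pow x k))
eval-as-sum (a ∷ [])    zero    x _         = trans (*-identityʳ a) (sym (trans (cong (a +_) (*-zeroʳ x)) (+-identityʳ a)))
eval-as-sum (a ∷ b ∷ P) zero    x (s≤s ())
eval-as-sum (a ∷ P)     (suc N) x (s≤s P≤1+N) = begin
  Σ≤ (suc N) (λ k → coeff (a ∷ P) k * pow x k)   ≡⟨ Σ≤-first N (λ k → coeff (a ∷ P) k * pow x k) ⟩
  a * 1ℚ + Σ≤ N (λ k → coeff P k * (x * pow x k))
    ≡⟨ cong₂ _+_ (*-identityʳ a) (Σ≤-cong N (λ k → solve 3 (λ c x y → c :* (x :* y) := x :* (c :* y)) refl (coeff P k) x (pow x k))) ⟩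
  a + Σ≤ N (λ k → x * (coeff P k * pow x k))  ≡⟨ cong (a +_) (sym (Σ≤-*ˡ N x _)) ⟩
  a + x * Σ≤ N (λ k → coeff P k * pow x k)    ≡⟨ cong (λ z → a + x * z) (eval-as-sum P N x P≤1+N) ⟩
  a + x * eval P x                            ∎
  where open ≡-Reasoning

-- (m)_p = p! C(m,p), using  p! C(m,p) (m-p) = (p+1)! C(m,p+1).
fallingX-at : ∀ p m → eval (fallingX p) (ℕ→ℚ m) ≡ ℕ→ℚ (p ! ℕ.* (m C p))
fallingX-at zero    m = trans (cong (1ℚ +_) (*-zeroʳ (ℕ→ℚ m))) (+-identityʳ 1ℚ)
fallingX-at (suc p) m = begin
  eval (pmul (fallingX p) (xPlus (- ℕ→ℚ p))) (ℕ→ℚ m)          ≡⟨ eval-pmul (fallingX p) (xPlus (- ℕ→ℚ p)) (ℕ→ℚ m) ⟩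
  eval (fallingX p) (ℕ→ℚ m) * eval (xPlus (- ℕ→ℚ p)) (ℕ→ℚ m)  ≡⟨ cong₂ _*_ (fallingX-at p m) (eval-xPlus (- ℕ→ℚ p) (ℕ→ℚ m)) ⟩
  ℕ→ℚ (p ! ℕ.* (m C p)) * (ℕ→ℚ m + - ℕ→ℚ p)                   ≡⟨ next-factor ⟩
  ℕ→ℚ (suc p ! ℕ.* (m C suc p))                               ∎
  where
  open ≡-Reasoning
  step : p ! ℕ.* (m C p) ℕ.* (m ∸ p) ≡ suc p ! ℕ.* (m C suc p)
  step = begin
    p ! ℕ.* (m C p) ℕ.* (m ∸ p)      ≡⟨ ℕP.*-assoc (p !) (m C p) (m ∸ p) ⟩
    p ! ℕ.* ((m C p) ℕ.* (m ∸ p))    ≡⟨ cong (p ! ℕ.*_) (C-absorb′ m p) ⟩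
    p ! ℕ.* ((m C suc p) ℕ.* suc p)  ≡⟨ regroup (p !) (m C suc p) (suc p) ⟩
    suc p ℕ.* p ! ℕ.* (m C suc p)    ∎
    where
    regroup : ∀ f b s → f ℕ.* (b ℕ.* s) ≡ s ℕ.* f ℕ.* b
    regroup = ℕ-Ring.solve-∀
  next-factor : ℕ→ℚ (p ! ℕ.* (m C p)) * (ℕ→ℚ m + - ℕ→ℚ p) ≡ ℕ→ℚ (suc p ! ℕ.* (m C suc p))
  next-factor = [ within-range , out-of-range ]′ (ℕP.≤-<-connex p m)
    where
    within-range : p ≤ m → ℕ→ℚ (p ! ℕ.* (m C p)) * (ℕ→ℚ m + - ℕ→ℚ p) ≡ ℕ→ℚ (suc p ! ℕ.* (m C suc p))
    within-range p≤m = begin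
      ℕ→ℚ (p ! ℕ.* (m C p)) * (ℕ→ℚ m + - ℕ→ℚ p)  ≡⟨ cong (ℕ→ℚ (p ! ℕ.* (m C p)) *_) (sym (ℕ→ℚ-∸ m p p≤m)) ⟩
      ℕ→ℚ (p ! ℕ.* (m C p)) * ℕ→ℚ (m ∸ p)        ≡⟨ sym (ℕ→ℚ-* (p ! ℕ.* (m C p)) (m ∸ p)) ⟩
      ℕ→ℚ (p ! ℕ.* (m C p) ℕ.* (m ∸ p))          ≡⟨ cong ℕ→ℚ step ⟩
      ℕ→ℚ (suc p ! ℕ.* (m C suc p))              ∎
    out-of-range : m < p → ℕ→ℚ (p ! ℕ.* (m C p)) * (ℕ→ℚ m + - ℕ→ℚ p) ≡ ℕ→ℚ (suc p ! ℕ.* (m C suc p))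
    out-of-range m<p = begin
      ℕ→ℚ (p ! ℕ.* (m C p)) * (ℕ→ℚ m + - ℕ→ℚ p)  ≡⟨ cong (λ z → ℕ→ℚ (p ! ℕ.* z) * (ℕ→ℚ m + - ℕ→ℚ p)) (k>n⇒nCk≡0 m<p) ⟩
      ℕ→ℚ (p ! ℕ.* 0) * (ℕ→ℚ m + - ℕ→ℚ p)        ≡⟨ cong (λ z → ℕ→ℚ z * (ℕ→ℚ m + - ℕ→ℚ p)) (ℕP.*-zeroʳ (p !)) ⟩
      0ℚ * (ℕ→ℚ m + - ℕ→ℚ p)                     ≡⟨ *-zeroˡ (ℕ→ℚ m + - ℕ→ℚ p) ⟩
      0ℚ                                         ≡⟨ cong ℕ→ℚ (sym (ℕP.*-zeroʳ (suc p !))) ⟩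
      ℕ→ℚ (suc p ! ℕ.* 0)                        ≡⟨ cong (λ z → ℕ→ℚ (suc p ! ℕ.* z)) (sym (k>n⇒nCk≡0 (ℕP.m<n⇒m<1+n m<p))) ⟩
      ℕ→ℚ (suc p ! ℕ.* (m C suc p))              ∎

factorial-absorb : ∀ a N → a ! ℕ.* (N C a) ℕ.* suc N ≡ suc a ! ℕ.* (suc N C suc a)
factorial-absorb a N = begin
  a ! ℕ.* (N C a) ℕ.* suc N            ≡⟨ regroup (a !) (N C a) (suc N) ⟩
  a ! ℕ.* (suc N ℕ.* (N C a))          ≡⟨ cong (a ! ℕ.*_) (sym (C-absorb N a)) ⟩
  a ! ℕ.* ((suc N C suc a) ℕ.* suc a)  ≡⟨ regroup′ (a !) (suc N C suc a) (suc a) ⟩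
  suc a ℕ.* a ! ℕ.* (suc N C suc a)    ∎
  where
  open ≡-Reasoning
  regroup : ∀ f b s → f ℕ.* b ℕ.* s ≡ f ℕ.* (s ℕ.* b)
  regroup = ℕ-Ring.solve-∀
  regroup′ : ∀ f b s → f ℕ.* (b ℕ.* s) ≡ s ℕ.* f ℕ.* b
  regroup′ = ℕ-Ring.solve-∀

risingX1-at : ∀ p k m → ℕ→ℚ (p ! ℕ.* (m C p)) * eval (risingX1 k) (ℕ→ℚ m) ≡ ℕ→ℚ ((p ℕ.+ k) ! ℕ.* ((m ℕ.+ k) C (p ℕ.+ k)))
risingX1-at p zero    m = begin
  ℕ→ℚ (p ! ℕ.* (m C p)) * (1ℚ + ℕ→ℚ m * 0ℚ)      ≡⟨ cong (λ z → ℕ→ℚ (p ! ℕ.* (m C p)) * (1ℚ + z)) (*-zeroʳ (ℕ→ℚ m)) ⟩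
  ℕ→ℚ (p ! ℕ.* (m C p)) * (1ℚ + 0ℚ)              ≡⟨ *-identityʳ (ℕ→ℚ (p ! ℕ.* (m C p))) ⟩
  ℕ→ℚ (p ! ℕ.* (m C p))                          ≡⟨ cong₂ (λ a b → ℕ→ℚ (a ! ℕ.* (b C a))) (sym (ℕP.+-identityʳ p)) (sym (ℕP.+-identityʳ m)) ⟩
  ℕ→ℚ ((p ℕ.+ 0) ! ℕ.* ((m ℕ.+ 0) C (p ℕ.+ 0)))  ∎
  where open ≡-Reasoning
risingX1-at p (suc k) m = begin
  c * eval (pmul (risingX1 k) (xPlus (ℕ→ℚ (suc k)))) (ℕ→ℚ m)
    ≡⟨ cong (c *_) (eval-pmul (risingX1 k) (xPlus (ℕ→ℚ (suc k))) (ℕ→ℚ m)) ⟩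
  c * (eval (risingX1 k) (ℕ→ℚ m) * eval (xPlus (ℕ→ℚ (suc k))) (ℕ→ℚ m))
    ≡⟨ sym (*-assoc c _ _) ⟩
  c * eval (risingX1 k) (ℕ→ℚ m) * eval (xPlus (ℕ→ℚ (suc k))) (ℕ→ℚ m)
    ≡⟨ cong₂ _*_ (risingX1-at p k m) (trans (eval-xPlus (ℕ→ℚ (suc k)) (ℕ→ℚ m)) (sym (ℕ→ℚ-+ m (suc k)))) ⟩
  ℕ→ℚ ((p ℕ.+ k) ! ℕ.* ((m ℕ.+ k) C (p ℕ.+ k))) * ℕ→ℚ (m ℕ.+ suc k)
    ≡⟨ sym (ℕ→ℚ-* ((p ℕ.+ k) ! ℕ.* ((m ℕ.+ k) C (p ℕ.+ k))) (m ℕ.+ suc k)) ⟩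
  ℕ→ℚ ((p ℕ.+ k) ! ℕ.* ((m ℕ.+ k) C (p ℕ.+ k)) ℕ.* (m ℕ.+ suc k))
    ≡⟨ cong (λ z → ℕ→ℚ ((p ℕ.+ k) ! ℕ.* ((m ℕ.+ k) C (p ℕ.+ k)) ℕ.* z)) (ℕP.+-suc m k) ⟩
  ℕ→ℚ ((p ℕ.+ k) ! ℕ.* ((m ℕ.+ k) C (p ℕ.+ k)) ℕ.* suc (m ℕ.+ k))
    ≡⟨ cong ℕ→ℚ (factorial-absorb (p ℕ.+ k) (m ℕ.+ k)) ⟩
  ℕ→ℚ (suc (p ℕ.+ k) ! ℕ.* (suc (m ℕ.+ k) C suc (p ℕ.+ k)))
    ≡⟨ cong₂ (λ a b → ℕ→ℚ (a ! ℕ.* (b C a))) (sym (ℕP.+-suc p k)) (sym (ℕP.+-suc m k)) ⟩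
  ℕ→ℚ ((p ℕ.+ suc k) ! ℕ.* ((m ℕ.+ suc k) C (p ℕ.+ suc k))) ∎
  where
  open ≡-Reasoning
  c = ℕ→ℚ (p ! ℕ.* (m C p))

U⁻¹x^-at : ∀ p k m → eval (U⁻¹x^ (p ℕ.+ k) p) (ℕ→ℚ m) ≡ ℕ→ℚ ((p ℕ.+ k) !) * binom (m ℕ.+ k) (p ℕ.+ k)
U⁻¹x^-at p k m = begin
  eval (U⁻¹x^ (p ℕ.+ k) p) (ℕ→ℚ m)
    ≡⟨ eval-pmul (fallingX p) (risingX1 (p ℕ.+ k ∸ p)) (ℕ→ℚ m) ⟩
  eval (fallingX p) (ℕ→ℚ m) * eval (risingX1 (p ℕ.+ k ∸ p)) (ℕ→ℚ m)
    ≡⟨ cong₂ _*_ (fallingX-at p m) (cong (λ z → eval (risingX1 z) (ℕ→ℚ m)) (ℕP.m+n∸m≡n p k)) ⟩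
  ℕ→ℚ (p ! ℕ.* (m C p)) * eval (risingX1 k) (ℕ→ℚ m)
    ≡⟨ risingX1-at p k m ⟩
  ℕ→ℚ ((p ℕ.+ k) ! ℕ.* ((m ℕ.+ k) C (p ℕ.+ k)))
    ≡⟨ ℕ→ℚ-* ((p ℕ.+ k) !) ((m ℕ.+ k) C (p ℕ.+ k)) ⟩
  ℕ→ℚ ((p ℕ.+ k) !) * ℕ→ℚ ((m ℕ.+ k) C (p ℕ.+ k))
    ≡⟨ cong (ℕ→ℚ ((p ℕ.+ k) !) *_) (sym (binom-def (m ℕ.+ k) (p ℕ.+ k))) ⟩
  ℕ→ℚ ((p ℕ.+ k) !) * binom (m ℕ.+ k) (p ℕ.+ k) ∎
  where open ≡-Reasoning

-- The closed form of S_n = F_n U_n⁻¹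

Fℕ : ℕ → ℕ → ℕ → ℚ
Fℕ N j p = Σ≤ j (λ i →
  sgn i * ℕ→ℚ (suc (2 ℕ.* N) C i) * ℕ→ℚ (((j ∸ i) ℕ.^ p) ℕ.* ((j ∸ i ℕ.+ N) C N)))

F-apply : ∀ N j P → length P ≤ suc N →
  Σ≤ N (λ k → Fℕ N j k * coeff P k) ≡ ([1-x]^ (suc (2 ℕ.* N)) ⋆ (λ m → binom (m ℕ.+ N) N * eval P (ℕ→ℚ m))) j
F-apply N j P P≤1+N = begin
  Σ≤ N (λ k → Fℕ N j k * coeff P k)                ≡⟨ Σ≤-cong N (λ k → Σ≤-*ʳ j _ (coeff P k)) ⟩
  Σ≤ N (λ k → Σ≤ j (λ i → entry i k * coeff P k))  ≡⟨ Σ≤-swap N j _ ⟩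
  Σ≤ j (λ i → Σ≤ N (λ k → entry i k * coeff P k))  ≡⟨ Σ≤-cong j (λ i → Σ≤-cong N (λ k → factor i k)) ⟩
  Σ≤ j (λ i → Σ≤ N (λ k → a i * (coeff P k * pow (ℕ→ℚ (j ∸ i)) k)))
    ≡⟨ Σ≤-cong j (λ i → sym (Σ≤-*ˡ N (a i) _)) ⟩
  Σ≤ j (λ i → a i * Σ≤ N (λ k → coeff P k * pow (ℕ→ℚ (j ∸ i)) k))
    ≡⟨ Σ≤-cong j (λ i → cong (a i *_) (eval-as-sum P N (ℕ→ℚ (j ∸ i)) P≤1+N)) ⟩
  Σ≤ j (λ i → a i * eval P (ℕ→ℚ (j ∸ i)))             ≡⟨ Σ≤-cong j (λ i → reassoc i) ⟩
  ([1-x]^ (suc (2 ℕ.* N)) ⋆ (λ m → binom (m ℕ.+ N) N * eval P (ℕ→ℚ m))) j ∎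
  where
  open ≡-Reasoning
  entry : ℕ → ℕ → ℚ
  entry i k = sgn i * ℕ→ℚ (suc (2 ℕ.* N) C i) * ℕ→ℚ (((j ∸ i) ℕ.^ k) ℕ.* ((j ∸ i ℕ.+ N) C N))
  a : ℕ → ℚ
  a i = sgn i * binom (suc (2 ℕ.* N)) i * binom (j ∸ i ℕ.+ N) N
  factor : ∀ i k → entry i k * coeff P k ≡ a i * (coeff P k * pow (ℕ→ℚ (j ∸ i)) k)
  factor i k = begin
    entry i k * coeff P k
      ≡⟨ cong₂ (λ y z → sgn i * y * z * coeff P k) (sym (binom-def (suc (2 ℕ.* N)) i))
           (trans (ℕ→ℚ-* ((j ∸ i) ℕ.^ k) ((j ∸ i ℕ.+ N) C N))
                  (cong₂ _*_ (ℕ→ℚ-^ (j ∸ i) k) (sym (binom-def (j ∸ i ℕ.+ N) N)))) ⟩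
    sgn i * binom (suc (2 ℕ.* N)) i * (pow (ℕ→ℚ (j ∸ i)) k * binom (j ∸ i ℕ.+ N) N) * coeff P k
      ≡⟨ solve 5 (λ s b x y c → s :* b :* (x :* y) :* c := (s :* b :* y) :* (c :* x)) refl
           (sgn i) (binom (suc (2 ℕ.* N)) i) (pow (ℕ→ℚ (j ∸ i)) k) (binom (j ∸ i ℕ.+ N) N) (coeff P k) ⟩
    a i * (coeff P k * pow (ℕ→ℚ (j ∸ i)) k) ∎
  reassoc : ∀ i → a i * eval P (ℕ→ℚ (j ∸ i))
                ≡ [1-x]^ (suc (2 ℕ.* N)) i * (binom (j ∸ i ℕ.+ N) N * eval P (ℕ→ℚ (j ∸ i)))
  reassoc i = *-assoc (sgn i * binom (suc (2 ℕ.* N)) i) (binom (j ∸ i ℕ.+ N) N) (eval P (ℕ→ℚ (j ∸ i)))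

Sℕ : ℕ → ℕ → ℕ → ℚ
Sℕ N j p with p ℕ.≤? j
... | yes _ = ℕ→ℚ (N !) * (binom (N ∸ p) (j ∸ p) * binom (N ℕ.+ p) j)
... | no _  = 0ℚ

Sℕ-above : ∀ N j p → p ≤ j → Sℕ N j p ≡ ℕ→ℚ (N !) * (binom (N ∸ p) (j ∸ p) * binom (N ℕ.+ p) j)
Sℕ-above N j p p≤j with p ℕ.≤? j
... | yes _   = refl
... | no  p≰j = contradiction p≤j p≰j

Sℕ-below : ∀ N j p → j < p → Sℕ N j p ≡ 0ℚ
Sℕ-below N j p j<p with p ℕ.≤? j
... | yes p≤j = contradiction j<p (ℕP.≤⇒≯ p≤j)
... | no  _   = refl

-- Column p of S_n is n! (1-x)^(2n+1) G, with G as in ColumnIdentity.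
S-column : ∀ p k j → j ≤ p ℕ.+ k →
  Σ≤ (p ℕ.+ k) (λ i → Fℕ (p ℕ.+ k) j i * coeff (U⁻¹x^ (p ℕ.+ k) p) i) ≡ Sℕ (p ℕ.+ k) j p
S-column p k j j≤n = trans (F-apply n j (U⁻¹x^ n p) (length-U⁻¹x^ p k)) (trans (scale j) (read-off j j≤n))
  where
  open ColumnIdentity p k
  scale : E ⋆ (λ m → binom (m ℕ.+ n) n * eval (U⁻¹x^ n p) (ℕ→ℚ m)) ≈ ℕ→ℚ (n !) · (E ⋆ G)
  scale = begin
    E ⋆ (λ m → binom (m ℕ.+ n) n * eval (U⁻¹x^ n p) (ℕ→ℚ m))  ≈⟨ ⋆-congʳ E evaluate ⟩
    E ⋆ (ℕ→ℚ (n !) · G)                                       ≈⟨ ⋆-comm E (ℕ→ℚ (n !) · G) ⟩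
    (ℕ→ℚ (n !) · G) ⋆ E                                       ≈⟨ ⋆-·ˡ (ℕ→ℚ (n !)) G E ⟩
    ℕ→ℚ (n !) · (G ⋆ E)                                       ≈⟨ ·-cong (ℕ→ℚ (n !)) (⋆-comm G E) ⟩
    ℕ→ℚ (n !) · (E ⋆ G)                                       ∎
    where
    open ≈-Reasoning
    evaluate : (λ m → binom (m ℕ.+ n) n * eval (U⁻¹x^ n p) (ℕ→ℚ m)) ≈ ℕ→ℚ (n !) · G
    evaluate m = trans (cong (binom (m ℕ.+ n) n *_) (U⁻¹x^-at p k m))
      (solve 3 (λ b f c → b :* (f :* c) := f :* (b :* c)) refl (binom (m ℕ.+ n) n) (ℕ→ℚ (n !)) (binom (m ℕ.+ k) n))
  read-off : ∀ j → j ≤ n → ℕ→ℚ (n !) * (E ⋆ G) j ≡ Sℕ n j p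
  read-off j j≤n = [ above , below ]′ (ℕP.≤-<-connex p j)
    where
    below : j < p → ℕ→ℚ (n !) * (E ⋆ G) j ≡ Sℕ n j p
    below j<p = begin
      ℕ→ℚ (n !) * (E ⋆ G) j  ≡⟨ cong (ℕ→ℚ (n !) *_) (coefficient-below j j<p) ⟩
      ℕ→ℚ (n !) * 0ℚ         ≡⟨ *-zeroʳ (ℕ→ℚ (n !)) ⟩
      0ℚ                     ≡⟨ sym (Sℕ-below n j p j<p) ⟩
      Sℕ n j p               ∎
      where open ≡-Reasoning
    above : p ≤ j → ℕ→ℚ (n !) * (E ⋆ G) j ≡ Sℕ n j p
    above p≤j = begin
      ℕ→ℚ (n !) * (E ⋆ G) j
        ≡⟨ cong (λ i → ℕ→ℚ (n !) * (E ⋆ G) i) (sym p+s≡j) ⟩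
      ℕ→ℚ (n !) * (E ⋆ G) (p ℕ.+ s)
        ≡⟨ cong (ℕ→ℚ (n !) *_) (coefficient-above s s≤k) ⟩
      ℕ→ℚ (n !) * (binom k s * binom (n ℕ.+ p) (p ℕ.+ s))
        ≡⟨ cong₂ (λ a b → ℕ→ℚ (n !) * (binom a s * binom (n ℕ.+ p) b)) (sym (ℕP.m+n∸m≡n p k)) p+s≡j ⟩
      ℕ→ℚ (n !) * (binom (n ∸ p) s * binom (n ℕ.+ p) j)
        ≡⟨ sym (Sℕ-above n j p p≤j) ⟩
      Sℕ n j p ∎
      where
      open ≡-Reasoning
      s = j ∸ p
      p+s≡j : p ℕ.+ s ≡ j
      p+s≡j = ℕP.m+[n∸m]≡n p≤j
      s≤k : s ≤ k
      s≤k = ℕP.+-cancelˡ-≤ p s k (subst (_≤ n) (sym p+s≡j) j≤n)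

S-closed : ∀ n (j p : Fin (suc n)) → S n j p ≡ Sℕ n (toℕ j) (toℕ p)
S-closed n j p = trans (ΣFin-Σ≤ n _ (λ i → Fℕ n (toℕ j) i * coeff (U⁻¹x^ n (toℕ p)) i) (λ _ → refl))
  (subst (λ N → Σ≤ N (λ i → Fℕ N (toℕ j) i * coeff (U⁻¹x^ N (toℕ p)) i) ≡ Sℕ N (toℕ j) (toℕ p)) p+k≡n
    (S-column (toℕ p) (n ∸ toℕ p) (toℕ j) (subst (toℕ j ≤_) (sym p+k≡n) (FinP.toℕ≤pred[n] j))))
  where
  p+k≡n : toℕ p ℕ.+ (n ∸ toℕ p) ≡ n
  p+k≡n = ℕP.m+[n∸m]≡n (FinP.toℕ≤pred[n] p)

-- The series (1+x)^n and (1+x)^-n are mutually inverse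

fallingℤ-suc : ∀ c t → fallingℤ (c ℤ.+ ℤ.+ 1) (suc t) ≡ (c ℤ.+ ℤ.+ 1) ℤ.* fallingℤ c t
fallingℤ-suc c zero    = first-factor c
  where
  first-factor : ∀ c → ℤ.+ 1 ℤ.* ((c ℤ.+ ℤ.+ 1) ℤ.- ℤ.+ 0) ≡ (c ℤ.+ ℤ.+ 1) ℤ.* ℤ.+ 1
  first-factor = ℤ-Ring.solve-∀
fallingℤ-suc c (suc t) = begin
  fallingℤ (c ℤ.+ ℤ.+ 1) (suc t) ℤ.* ((c ℤ.+ ℤ.+ 1) ℤ.- ℤ.+ suc t)  ≡⟨ cong (ℤ._* ((c ℤ.+ ℤ.+ 1) ℤ.- ℤ.+ suc t)) (fallingℤ-suc c t) ⟩
  (c ℤ.+ ℤ.+ 1) ℤ.* fallingℤ c t ℤ.* ((c ℤ.+ ℤ.+ 1) ℤ.- ℤ.+ suc t)  ≡⟨ regroup c (fallingℤ c t) (ℤ.+ t) ⟩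
  (c ℤ.+ ℤ.+ 1) ℤ.* (fallingℤ c t ℤ.* (c ℤ.- ℤ.+ t))                ∎
  where
  open ≡-Reasoning
  regroup : ∀ c f t → (c ℤ.+ ℤ.+ 1) ℤ.* f ℤ.* ((c ℤ.+ ℤ.+ 1) ℤ.- (ℤ.+ 1 ℤ.+ t)) ≡ (c ℤ.+ ℤ.+ 1) ℤ.* (f ℤ.* (c ℤ.- t))
  regroup = ℤ-Ring.solve-∀

recip-factorial : ∀ t → recip (t !) {{t ℕP.!≢0}} ≡ ℕ→ℚ (suc t) * recip (suc t !) {{suc t ℕP.!≢0}}
recip-factorial t = ℕ→ℚ-*-cancelˡ (t !) {{t ℕP.!≢0}} (begin
  ℕ→ℚ (t !) * w t                        ≡⟨ *-comm (ℕ→ℚ (t !)) (w t) ⟩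
  w t * ℕ→ℚ (t !)                        ≡⟨ recip-inverse (t !) {{t ℕP.!≢0}} ⟩
  1ℚ                                     ≡⟨ sym (recip-inverse (suc t !) {{suc t ℕP.!≢0}}) ⟩
  w (suc t) * ℕ→ℚ (suc t !)              ≡⟨ cong (w (suc t) *_) (ℕ→ℚ-* (suc t) (t !)) ⟩
  w (suc t) * (ℕ→ℚ (suc t) * ℕ→ℚ (t !))  ≡⟨ solve 3 (λ a b c → c :* (b :* a) := a :* (b :* c)) refl (ℕ→ℚ (t !)) (ℕ→ℚ (suc t)) (w (suc t)) ⟩
  ℕ→ℚ (t !) * (ℕ→ℚ (suc t) * w (suc t))  ∎)
  where
  open ≡-Reasoning
  w : ℕ → ℚ
  w t = recip (t !) {{t ℕP.!≢0}}

binomℤ-as-recip : ∀ c t → binomℤ c t ≡ ℤ→ℚ (fallingℤ c t) * recip (t !) {{t ℕP.!≢0}}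
binomℤ-as-recip c t = /-as-recip (fallingℤ c t) (t !) {{t ℕP.!≢0}}

binomℤ-pascal : ∀ c t → binomℤ (c ℤ.+ ℤ.+ 1) (suc t) ≡ binomℤ c (suc t) + binomℤ c t
binomℤ-pascal c t = begin
  binomℤ (c ℤ.+ ℤ.+ 1) (suc t)                      ≡⟨ binomℤ-as-recip (c ℤ.+ ℤ.+ 1) (suc t) ⟩
  ℤ→ℚ (fallingℤ (c ℤ.+ ℤ.+ 1) (suc t)) * w (suc t)  ≡⟨ cong (λ z → ℤ→ℚ z * w (suc t)) (trans (fallingℤ-suc c t) (split c f t)) ⟩
  ℤ→ℚ (f ℤ.* (c ℤ.- ℤ.+ t) ℤ.+ f ℤ.* ℤ.+ suc t) * w (suc t)
    ≡⟨ cong (_* w (suc t)) (trans (ℤ→ℚ-+ (f ℤ.* (c ℤ.- ℤ.+ t)) (f ℤ.* ℤ.+ suc t)) (cong (ℤ→ℚ (f ℤ.* (c ℤ.- ℤ.+ t)) +_) (ℤ→ℚ-* f (ℤ.+ suc t)))) ⟩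
  (ℤ→ℚ (f ℤ.* (c ℤ.- ℤ.+ t)) + ℤ→ℚ f * ℕ→ℚ (suc t)) * w (suc t)
    ≡⟨ solve 4 (λ a b s w → (a :+ b :* s) :* w := a :* w :+ b :* (s :* w)) refl
         (ℤ→ℚ (f ℤ.* (c ℤ.- ℤ.+ t))) (ℤ→ℚ f) (ℕ→ℚ (suc t)) (w (suc t)) ⟩
  ℤ→ℚ (fallingℤ c (suc t)) * w (suc t) + ℤ→ℚ f * (ℕ→ℚ (suc t) * w (suc t))
    ≡⟨ cong (λ z → ℤ→ℚ (fallingℤ c (suc t)) * w (suc t) + ℤ→ℚ f * z) (sym (recip-factorial t)) ⟩
  ℤ→ℚ (fallingℤ c (suc t)) * w (suc t) + ℤ→ℚ f * w t  ≡⟨ sym (cong₂ _+_ (binomℤ-as-recip c (suc t)) (binomℤ-as-recip c t)) ⟩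
  binomℤ c (suc t) + binomℤ c t                       ∎
  where
  open ≡-Reasoning
  f = fallingℤ c t
  w : ℕ → ℚ
  w t = recip (t !) {{t ℕP.!≢0}}
  split′ : ∀ c f s → (c ℤ.+ ℤ.+ 1) ℤ.* f ≡ f ℤ.* (c ℤ.- s) ℤ.+ f ℤ.* (ℤ.+ 1 ℤ.+ s)
  split′ = ℤ-Ring.solve-∀
  split : ∀ c f t → (c ℤ.+ ℤ.+ 1) ℤ.* f ≡ f ℤ.* (c ℤ.- ℤ.+ t) ℤ.+ f ℤ.* ℤ.+ suc t
  split c f t = split′ c f (ℤ.+ t)

[1+x]^ : ℕ → Series
[1+x]^ n t = binom n t

[1+x]^- : ℕ → Series
[1+x]^- n t = binomℤ (ℤ.- (ℤ.+ n)) t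

[1+x]⋆ : ∀ g → g ⋆ (δ ⊕ X δ) ≈ g ⊕ X g
[1+x]⋆ g = ≈-trans (⋆-⊕ʳ g δ (X δ)) (⊕-cong (⋆-δʳ g) (≈-trans (⋆-Xʳ g δ) (X-cong (⋆-δʳ g))))

[1+x]^-suc : ∀ n → [1+x]^ n ⋆ (δ ⊕ X δ) ≈ [1+x]^ (suc n)
[1+x]^-suc n = ≈-trans ([1+x]⋆ ([1+x]^ n)) pascal
  where
  pascal : [1+x]^ n ⊕ X ([1+x]^ n) ≈ [1+x]^ (suc n)
  pascal zero    = trans (+-identityʳ (binom n 0)) (trans (binom-zero n) (sym (binom-zero (suc n))))
  pascal (suc t) = trans (+-comm (binom n (suc t)) (binom n t)) (sym (binom-pascal n t))

[1+x]^--suc : ∀ n → [1+x]^- (suc n) ⋆ (δ ⊕ X δ) ≈ [1+x]^- n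
[1+x]^--suc n = ≈-trans ([1+x]⋆ ([1+x]^- (suc n))) pascal
  where
  -n≡-[n+1]+1 : ∀ n → ℤ.- (ℤ.+ n) ≡ ℤ.- (ℤ.+ suc n) ℤ.+ ℤ.+ 1
  -n≡-[n+1]+1 zero    = refl
  -n≡-[n+1]+1 (suc n) = refl
  pascal : [1+x]^- (suc n) ⊕ X ([1+x]^- (suc n)) ≈ [1+x]^- n
  pascal zero    = +-identityʳ 1ℚ
  pascal (suc t) = trans (sym (binomℤ-pascal (ℤ.- (ℤ.+ suc n)) t)) (cong (λ c → binomℤ c (suc t)) (sym (-n≡-[n+1]+1 n)))

[1+x]^0 : [1+x]^ 0 ≈ δ
[1+x]^0 zero    = binom-zero 0
[1+x]^0 (suc t) = binom-vanish 0 (suc t) (s≤s z≤n)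

[1+x]^-0 : [1+x]^- 0 ≈ δ
[1+x]^-0 zero    = refl
[1+x]^-0 (suc t) = trans (binomℤ-as-recip (ℤ.+ 0) (suc t))
  (trans (cong (λ z → ℤ→ℚ z * recip (suc t !) {{suc t ℕP.!≢0}}) (falling-0 t)) (*-zeroˡ (recip (suc t !) {{suc t ℕP.!≢0}})))
  where
  falling-0 : ∀ t → fallingℤ (ℤ.+ 0) (suc t) ≡ ℤ.+ 0
  falling-0 zero    = refl
  falling-0 (suc t) = trans (cong (ℤ._* (ℤ.+ 0 ℤ.- ℤ.+ suc t)) (falling-0 t)) (ℤP.*-zeroˡ (ℤ.+ 0 ℤ.- ℤ.+ suc t))

[1+x]^-inverse : ∀ n → [1+x]^- n ⋆ [1+x]^ n ≈ δ
[1+x]^-inverse zero    = ≈-trans (⋆-cong [1+x]^-0 [1+x]^0) (⋆-δˡ δ)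
[1+x]^-inverse (suc n) = begin
  [1+x]^- (suc n) ⋆ [1+x]^ (suc n)          ≈⟨ ⋆-congʳ ([1+x]^- (suc n)) ([1+x]^-suc n) ⟨
  [1+x]^- (suc n) ⋆ ([1+x]^ n ⋆ (δ ⊕ X δ))  ≈⟨ ⋆-congʳ ([1+x]^- (suc n)) (⋆-comm ([1+x]^ n) (δ ⊕ X δ)) ⟩
  [1+x]^- (suc n) ⋆ ((δ ⊕ X δ) ⋆ [1+x]^ n)  ≈⟨ ⋆-assoc ([1+x]^- (suc n)) (δ ⊕ X δ) ([1+x]^ n) ⟨
  ([1+x]^- (suc n) ⋆ (δ ⊕ X δ)) ⋆ [1+x]^ n  ≈⟨ ⋆-congˡ ([1+x]^ n) ([1+x]^--suc n) ⟩
  [1+x]^- n ⋆ [1+x]^ n                      ≈⟨ [1+x]^-inverse n ⟩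
  δ                                         ∎
  where open ≈-Reasoning

-- Three factorial identities.  Each is checked by multiplying out with
-- C-factorial; the variables a, b, c are the gaps between the indices.

factorial-identity₁ : ∀ a b c → let N = c ℕ.+ a ℕ.+ b in
  (c ℕ.+ a) ! ℕ.* b ! ℕ.* N ! ℕ.* ((a ℕ.+ b) C a) ℕ.* ((N ℕ.+ c) C (c ℕ.+ a)) ℕ.* ((2 ℕ.* N) C (a ℕ.+ b))
  ≡ (2 ℕ.* N) ! ℕ.* (N C a)
factorial-identity₁ a b c = ℕP.*-cancelʳ-≡ _ _ (a ! ℕ.* (b ℕ.+ c) !) {{a ℕP.!* (b ℕ.+ c) !≢0}} (begin
  (c ℕ.+ a) ! ℕ.* b ! ℕ.* N ! ℕ.* C₁ ℕ.* C₂ ℕ.* C₃ ℕ.* (a ! ℕ.* (b ℕ.+ c) !)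
    ≡⟨ regroup ((c ℕ.+ a) !) (b !) (N !) C₁ C₂ C₃ (a !) ((b ℕ.+ c) !) ⟩
  C₁ ℕ.* (a ! ℕ.* b !) ℕ.* (C₂ ℕ.* ((c ℕ.+ a) ! ℕ.* (b ℕ.+ c) !)) ℕ.* N ! ℕ.* C₃
    ≡⟨ cong₂ (λ x y → x ℕ.* y ℕ.* N ! ℕ.* C₃) (C-factorial a b (a ℕ.+ b) refl)
              (C-factorial (c ℕ.+ a) (b ℕ.+ c) (N ℕ.+ c) (sum₁ a b c)) ⟩
  (a ℕ.+ b) ! ℕ.* (N ℕ.+ c) ! ℕ.* N ! ℕ.* C₃
    ≡⟨ regroup′ ((a ℕ.+ b) !) ((N ℕ.+ c) !) (N !) C₃ ⟩
  N ! ℕ.* (C₃ ℕ.* ((a ℕ.+ b) ! ℕ.* (N ℕ.+ c) !))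
    ≡⟨ cong (N ! ℕ.*_) (C-factorial (a ℕ.+ b) (N ℕ.+ c) (2 ℕ.* N) (sum₂ a b c)) ⟩
  N ! ℕ.* (2 ℕ.* N) !
    ≡⟨ cong (λ z → z ℕ.* (2 ℕ.* N) !) (sym (C-factorial a (b ℕ.+ c) N (sum₃ a b c))) ⟩
  (N C a) ℕ.* (a ! ℕ.* (b ℕ.+ c) !) ℕ.* (2 ℕ.* N) !
    ≡⟨ regroup″ (N C a) (a ! ℕ.* (b ℕ.+ c) !) ((2 ℕ.* N) !) ⟩
  (2 ℕ.* N) ! ℕ.* (N C a) ℕ.* (a ! ℕ.* (b ℕ.+ c) !) ∎)
  where
  open ≡-Reasoning
  N  = c ℕ.+ a ℕ.+ b
  C₁ = (a ℕ.+ b) C a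
  C₂ = (N ℕ.+ c) C (c ℕ.+ a)
  C₃ = (2 ℕ.* N) C (a ℕ.+ b)
  regroup : ∀ fca fb fN x y z fa fbc →
    fca ℕ.* fb ℕ.* fN ℕ.* x ℕ.* y ℕ.* z ℕ.* (fa ℕ.* fbc) ≡ x ℕ.* (fa ℕ.* fb) ℕ.* (y ℕ.* (fca ℕ.* fbc)) ℕ.* fN ℕ.* z
  regroup = ℕ-Ring.solve-∀
  regroup′ : ∀ u v w z → u ℕ.* v ℕ.* w ℕ.* z ≡ w ℕ.* (z ℕ.* (u ℕ.* v))
  regroup′ = ℕ-Ring.solve-∀
  regroup″ : ∀ x y z → x ℕ.* y ℕ.* z ≡ z ℕ.* x ℕ.* y
  regroup″ = ℕ-Ring.solve-∀
  sum₁ : ∀ a b c → c ℕ.+ a ℕ.+ (b ℕ.+ c) ≡ c ℕ.+ a ℕ.+ b ℕ.+ c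
  sum₁ = ℕ-Ring.solve-∀
  sum₂ : ∀ a b c → a ℕ.+ b ℕ.+ (c ℕ.+ a ℕ.+ b ℕ.+ c) ≡ 2 ℕ.* (c ℕ.+ a ℕ.+ b)
  sum₂ = ℕ-Ring.solve-∀
  sum₃ : ∀ a b c → a ℕ.+ (b ℕ.+ c) ≡ c ℕ.+ a ℕ.+ b
  sum₃ = ℕ-Ring.solve-∀

factorial-identity₂ : ∀ p a b → let N = p ℕ.+ a ℕ.+ b in
  (p ℕ.+ a) ! ℕ.* b ! ℕ.* N ! ℕ.* ((a ℕ.+ b) C a) ℕ.* ((N ℕ.+ p) C (p ℕ.+ a))
  ≡ (a ℕ.+ b) ! ℕ.* (N ℕ.+ p) ! ℕ.* (N C a)
factorial-identity₂ p a b = ℕP.*-cancelʳ-≡ _ _ (a ! ℕ.* (p ℕ.+ b) !) {{a ℕP.!* (p ℕ.+ b) !≢0}} (begin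
  (p ℕ.+ a) ! ℕ.* b ! ℕ.* N ! ℕ.* C₁ ℕ.* C₂ ℕ.* (a ! ℕ.* (p ℕ.+ b) !)
    ≡⟨ regroup ((p ℕ.+ a) !) (b !) (N !) C₁ C₂ (a !) ((p ℕ.+ b) !) ⟩
  C₁ ℕ.* (a ! ℕ.* b !) ℕ.* (C₂ ℕ.* ((p ℕ.+ a) ! ℕ.* (p ℕ.+ b) !)) ℕ.* N !
    ≡⟨ cong₂ (λ x y → x ℕ.* y ℕ.* N !) (C-factorial a b (a ℕ.+ b) refl)
              (C-factorial (p ℕ.+ a) (p ℕ.+ b) (N ℕ.+ p) (sum₁ p a b)) ⟩
  (a ℕ.+ b) ! ℕ.* (N ℕ.+ p) ! ℕ.* N !
    ≡⟨ cong ((a ℕ.+ b) ! ℕ.* (N ℕ.+ p) ! ℕ.*_) (sym (C-factorial a (p ℕ.+ b) N (sum₂ p a b))) ⟩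
  (a ℕ.+ b) ! ℕ.* (N ℕ.+ p) ! ℕ.* ((N C a) ℕ.* (a ! ℕ.* (p ℕ.+ b) !))
    ≡⟨ sym (ℕP.*-assoc ((a ℕ.+ b) ! ℕ.* (N ℕ.+ p) !) (N C a) _) ⟩
  (a ℕ.+ b) ! ℕ.* (N ℕ.+ p) ! ℕ.* (N C a) ℕ.* (a ! ℕ.* (p ℕ.+ b) !) ∎)
  where
  open ≡-Reasoning
  N  = p ℕ.+ a ℕ.+ b
  C₁ = (a ℕ.+ b) C a
  C₂ = (N ℕ.+ p) C (p ℕ.+ a)
  regroup : ∀ fpa fb fN x y fa fpb →
    fpa ℕ.* fb ℕ.* fN ℕ.* x ℕ.* y ℕ.* (fa ℕ.* fpb) ≡ x ℕ.* (fa ℕ.* fb) ℕ.* (y ℕ.* (fpa ℕ.* fpb)) ℕ.* fN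
  regroup = ℕ-Ring.solve-∀
  sum₁ : ∀ p a b → p ℕ.+ a ℕ.+ (p ℕ.+ b) ≡ p ℕ.+ a ℕ.+ b ℕ.+ p
  sum₁ = ℕ-Ring.solve-∀
  sum₂ : ∀ p a b → a ℕ.+ (p ℕ.+ b) ≡ p ℕ.+ a ℕ.+ b
  sum₂ = ℕ-Ring.solve-∀

factorial-identity₃ : ∀ n j → j ≤ n → (n ∸ j) ! ℕ.* (n ℕ.+ j) ! ℕ.* ((2 ℕ.* n) C (n ∸ j)) ≡ (2 ℕ.* n) !
factorial-identity₃ n j j≤n =
  trans (ℕP.*-comm ((n ∸ j) ! ℕ.* (n ℕ.+ j) !) ((2 ℕ.* n) C (n ∸ j))) (C-factorial (n ∸ j) (n ℕ.+ j) (2 ℕ.* n) sum)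
  where
  sum : n ∸ j ℕ.+ (n ℕ.+ j) ≡ 2 ℕ.* n
  sum = begin
    n ∸ j ℕ.+ (n ℕ.+ j)  ≡⟨ cong (n ∸ j ℕ.+_) (ℕP.+-comm n j) ⟩
    n ∸ j ℕ.+ (j ℕ.+ n)  ≡⟨ sym (ℕP.+-assoc (n ∸ j) j n) ⟩
    n ∸ j ℕ.+ j ℕ.+ n    ≡⟨ cong (ℕ._+ n) (ℕP.m∸n+n≡m j≤n) ⟩
    n ℕ.+ n              ≡⟨ cong (n ℕ.+_) (sym (ℕP.+-identityʳ n)) ⟩
    2 ℕ.* n              ∎
    where open ≡-Reasoning

-- The same identities in terms of the indices  p ≤ k ≤ j ≤ n  themselves.
k+a+b∸k≡a+b : ∀ k a b → k ℕ.+ a ℕ.+ b ∸ k ≡ a ℕ.+ b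
k+a+b∸k≡a+b k a b = trans (cong (_∸ k) (ℕP.+-assoc k a b)) (ℕP.m+n∸m≡n k (a ℕ.+ b))

ST-identity : ∀ n j k → k ≤ j → j ≤ n →
  j ! ℕ.* (n ∸ j) ! ℕ.* n ! ℕ.* ((n ∸ k) C (j ∸ k)) ℕ.* ((n ℕ.+ k) C j) ℕ.* ((2 ℕ.* n) C (n ∸ k))
  ≡ (2 ℕ.* n) ! ℕ.* (n C (j ∸ k))
ST-identity n j k k≤j j≤n with ℕP.m≤n⇒∃[o]m+o≡n k≤j | ℕP.m≤n⇒∃[o]m+o≡n j≤n
... | a , refl | b , refl
  rewrite ℕP.m+n∸m≡n (k ℕ.+ a) b | ℕP.m+n∸m≡n k a | k+a+b∸k≡a+b k a b = factorial-identity₁ a b k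

TS-identity : ∀ n k p → p ≤ k → k ≤ n →
  k ! ℕ.* (n ∸ k) ! ℕ.* n ! ℕ.* ((n ∸ p) C (k ∸ p)) ℕ.* ((n ℕ.+ p) C k)
  ≡ (n ∸ p) ! ℕ.* (n ℕ.+ p) ! ℕ.* (n C (k ∸ p))
TS-identity n k p p≤k k≤n with ℕP.m≤n⇒∃[o]m+o≡n p≤k | ℕP.m≤n⇒∃[o]m+o≡n k≤n
... | a , refl | b , refl
  rewrite ℕP.m+n∸m≡n (p ℕ.+ a) b | ℕP.m+n∸m≡n p a | k+a+b∸k≡a+b p a b = factorial-identity₂ p a b

T-scale : ℕ → ℕ → ℚ
T-scale n p = ((ℤ.+ (p ! ℕ.* (n ∸ p) !)) / ((2 ℕ.* n) !)) {{(2 ℕ.* n) ℕP.!≢0}}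

T-scale-cancel : ∀ n p → T-scale n p * ℕ→ℚ ((2 ℕ.* n) !) ≡ ℕ→ℚ (p ! ℕ.* (n ∸ p) !)
T-scale-cancel n p = /-*-cancel (p ! ℕ.* (n ∸ p) !) ((2 ℕ.* n) !) {{(2 ℕ.* n) ℕP.!≢0}}

Tℕ : ℕ → ℕ → ℕ → ℚ
Tℕ n m p with p ℕ.≤? m
... | yes _ = T-scale n p * binomℤ (ℤ.- (ℤ.+ n)) (m ∸ p) * ℕ→ℚ ((2 ℕ.* n) C (n ∸ m))
... | no _  = 0ℚ

T-closed : ∀ n (m p : Fin (suc n)) → T n m p ≡ Tℕ n (toℕ m) (toℕ p)
T-closed n m p with toℕ p ℕ.≤? toℕ m
... | yes _ = refl
... | no _  = refl

Tℕ-above : ∀ n m p → p ≤ m → Tℕ n m p ≡ T-scale n p * [1+x]^- n (m ∸ p) * binom (2 ℕ.* n) (n ∸ m)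
Tℕ-above n m p p≤m with p ℕ.≤? m
... | yes _   = cong (T-scale n p * [1+x]^- n (m ∸ p) *_) (sym (binom-def (2 ℕ.* n) (n ∸ m)))
... | no  p≰m = contradiction p≤m p≰m

Tℕ-below : ∀ n m p → m < p → Tℕ n m p ≡ 0ℚ
Tℕ-below n m p m<p with p ℕ.≤? m
... | yes p≤m = contradiction m<p (ℕP.≤⇒≯ p≤m)
... | no  _   = refl

ℕ→ℚ-*-binom : ∀ x a b → ℕ→ℚ x * binom a b ≡ ℕ→ℚ (x ℕ.* (a C b))
ℕ→ℚ-*-binom x a b = trans (cong (ℕ→ℚ x *_) (binom-def a b)) (sym (ℕ→ℚ-* x (a C b)))

ST-entry : ∀ n j k p → p ≤ k → k ≤ j → j ≤ n →
  ℕ→ℚ (j ! ℕ.* (n ∸ j) !) * (Sℕ n j k * Tℕ n k p)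
  ≡ ℕ→ℚ (p ! ℕ.* (n ∸ p) !) * ([1+x]^- n (k ∸ p) * [1+x]^ n (j ∸ k))
ST-entry n j k p p≤k k≤j j≤n = begin
  ℕ→ℚ D * (Sℕ n j k * Tℕ n k p)
    ≡⟨ cong₂ (λ x y → ℕ→ℚ D * (x * y)) (Sℕ-above n j k k≤j) (Tℕ-above n k p p≤k) ⟩
  ℕ→ℚ D * (ℕ→ℚ (n !) * (binom (n ∸ k) (j ∸ k) * binom (n ℕ.+ k) j) * (V * Q * binom (2 ℕ.* n) (n ∸ k)))
    ≡⟨ solve 7 (λ d f b₁ b₂ v q b₃ → d :* (f :* (b₁ :* b₂) :* (v :* q :* b₃)) := (d :* f :* b₁ :* b₂ :* b₃) :* (v :* q)) refl
         (ℕ→ℚ D) (ℕ→ℚ (n !)) (binom (n ∸ k) (j ∸ k)) (binom (n ℕ.+ k) j) V Q (binom (2 ℕ.* n) (n ∸ k)) ⟩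
  (ℕ→ℚ D * ℕ→ℚ (n !) * binom (n ∸ k) (j ∸ k) * binom (n ℕ.+ k) j * binom (2 ℕ.* n) (n ∸ k)) * (V * Q)
    ≡⟨ cong (_* (V * Q)) cast ⟩
  ℕ→ℚ (D ℕ.* n ! ℕ.* ((n ∸ k) C (j ∸ k)) ℕ.* ((n ℕ.+ k) C j) ℕ.* ((2 ℕ.* n) C (n ∸ k))) * (V * Q)
    ≡⟨ cong (λ z → ℕ→ℚ z * (V * Q)) (ST-identity n j k k≤j j≤n) ⟩
  ℕ→ℚ ((2 ℕ.* n) ! ℕ.* (n C (j ∸ k))) * (V * Q)
    ≡⟨ cong (_* (V * Q)) (sym (ℕ→ℚ-*-binom ((2 ℕ.* n) !) n (j ∸ k))) ⟩
  ℕ→ℚ ((2 ℕ.* n) !) * binom n (j ∸ k) * (V * Q)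
    ≡⟨ solve 4 (λ f b v q → f :* b :* (v :* q) := (v :* f) :* (q :* b)) refl (ℕ→ℚ ((2 ℕ.* n) !)) (binom n (j ∸ k)) V Q ⟩
  V * ℕ→ℚ ((2 ℕ.* n) !) * (Q * binom n (j ∸ k))
    ≡⟨ cong (_* (Q * binom n (j ∸ k))) (T-scale-cancel n p) ⟩
  ℕ→ℚ (p ! ℕ.* (n ∸ p) !) * (Q * binom n (j ∸ k)) ∎
  where
  open ≡-Reasoning
  D = j ! ℕ.* (n ∸ j) !
  V = T-scale n p
  Q = [1+x]^- n (k ∸ p)
  cast : ℕ→ℚ D * ℕ→ℚ (n !) * binom (n ∸ k) (j ∸ k) * binom (n ℕ.+ k) j * binom (2 ℕ.* n) (n ∸ k)
       ≡ ℕ→ℚ (D ℕ.* n ! ℕ.* ((n ∸ k) C (j ∸ k)) ℕ.* ((n ℕ.+ k) C j) ℕ.* ((2 ℕ.* n) C (n ∸ k)))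
  cast = begin
    ℕ→ℚ D * ℕ→ℚ (n !) * binom (n ∸ k) (j ∸ k) * binom (n ℕ.+ k) j * binom (2 ℕ.* n) (n ∸ k)
      ≡⟨ cong (λ z → z * binom (n ∸ k) (j ∸ k) * binom (n ℕ.+ k) j * binom (2 ℕ.* n) (n ∸ k)) (sym (ℕ→ℚ-* D (n !))) ⟩
    ℕ→ℚ (D ℕ.* n !) * binom (n ∸ k) (j ∸ k) * binom (n ℕ.+ k) j * binom (2 ℕ.* n) (n ∸ k)
      ≡⟨ cong (λ z → z * binom (n ℕ.+ k) j * binom (2 ℕ.* n) (n ∸ k)) (ℕ→ℚ-*-binom (D ℕ.* n !) (n ∸ k) (j ∸ k)) ⟩
    ℕ→ℚ (D ℕ.* n ! ℕ.* ((n ∸ k) C (j ∸ k))) * binom (n ℕ.+ k) j * binom (2 ℕ.* n) (n ∸ k)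
      ≡⟨ cong (_* binom (2 ℕ.* n) (n ∸ k)) (ℕ→ℚ-*-binom (D ℕ.* n ! ℕ.* ((n ∸ k) C (j ∸ k))) (n ℕ.+ k) j) ⟩
    ℕ→ℚ (D ℕ.* n ! ℕ.* ((n ∸ k) C (j ∸ k)) ℕ.* ((n ℕ.+ k) C j)) * binom (2 ℕ.* n) (n ∸ k)
      ≡⟨ ℕ→ℚ-*-binom (D ℕ.* n ! ℕ.* ((n ∸ k) C (j ∸ k)) ℕ.* ((n ℕ.+ k) C j)) (2 ℕ.* n) (n ∸ k) ⟩
    ℕ→ℚ (D ℕ.* n ! ℕ.* ((n ∸ k) C (j ∸ k)) ℕ.* ((n ℕ.+ k) C j) ℕ.* ((2 ℕ.* n) C (n ∸ k))) ∎

TS-entry : ∀ n j k p → p ≤ k → k ≤ j → j ≤ n →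
  ℕ→ℚ ((n ∸ j) ! ℕ.* (n ℕ.+ j) !) * (Tℕ n j k * Sℕ n k p)
  ≡ ℕ→ℚ ((n ∸ p) ! ℕ.* (n ℕ.+ p) !) * ([1+x]^ n (k ∸ p) * [1+x]^- n (j ∸ k))
TS-entry n j k p p≤k k≤j j≤n = begin
  ℕ→ℚ E * (Tℕ n j k * Sℕ n k p)
    ≡⟨ cong₂ (λ x y → ℕ→ℚ E * (x * y)) (Tℕ-above n j k k≤j) (Sℕ-above n k p p≤k) ⟩
  ℕ→ℚ E * (V * Q * binom (2 ℕ.* n) (n ∸ j) * (ℕ→ℚ (n !) * (binom (n ∸ p) (k ∸ p) * binom (n ℕ.+ p) k)))
    ≡⟨ solve 7 (λ e v q b₃ f b₁ b₂ → e :* (v :* q :* b₃ :* (f :* (b₁ :* b₂))) := v :* (e :* b₃) :* (f :* b₁ :* b₂) :* q) refl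
         (ℕ→ℚ E) V Q (binom (2 ℕ.* n) (n ∸ j)) (ℕ→ℚ (n !)) (binom (n ∸ p) (k ∸ p)) (binom (n ℕ.+ p) k) ⟩
  V * (ℕ→ℚ E * binom (2 ℕ.* n) (n ∸ j)) * (ℕ→ℚ (n !) * binom (n ∸ p) (k ∸ p) * binom (n ℕ.+ p) k) * Q
    ≡⟨ cong (λ z → V * z * (ℕ→ℚ (n !) * binom (n ∸ p) (k ∸ p) * binom (n ℕ.+ p) k) * Q)
         (trans (ℕ→ℚ-*-binom E (2 ℕ.* n) (n ∸ j)) (cong ℕ→ℚ (factorial-identity₃ n j j≤n))) ⟩
  V * ℕ→ℚ ((2 ℕ.* n) !) * (ℕ→ℚ (n !) * binom (n ∸ p) (k ∸ p) * binom (n ℕ.+ p) k) * Q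
    ≡⟨ cong₂ (λ x y → x * y * Q) (T-scale-cancel n k) cast ⟩
  ℕ→ℚ (k ! ℕ.* (n ∸ k) !) * ℕ→ℚ (n ! ℕ.* ((n ∸ p) C (k ∸ p)) ℕ.* ((n ℕ.+ p) C k)) * Q
    ≡⟨ cong (_* Q) (sym (ℕ→ℚ-* (k ! ℕ.* (n ∸ k) !) _)) ⟩
  ℕ→ℚ (k ! ℕ.* (n ∸ k) ! ℕ.* (n ! ℕ.* ((n ∸ p) C (k ∸ p)) ℕ.* ((n ℕ.+ p) C k))) * Q
    ≡⟨ cong (λ z → ℕ→ℚ z * Q) (trans (regroup (k ! ℕ.* (n ∸ k) !) (n !) ((n ∸ p) C (k ∸ p)) ((n ℕ.+ p) C k))
                                      (TS-identity n k p p≤k (ℕP.≤-trans k≤j j≤n))) ⟩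
  ℕ→ℚ ((n ∸ p) ! ℕ.* (n ℕ.+ p) ! ℕ.* (n C (k ∸ p))) * Q
    ≡⟨ cong (_* Q) (sym (ℕ→ℚ-*-binom ((n ∸ p) ! ℕ.* (n ℕ.+ p) !) n (k ∸ p))) ⟩
  ℕ→ℚ ((n ∸ p) ! ℕ.* (n ℕ.+ p) !) * binom n (k ∸ p) * Q
    ≡⟨ *-assoc (ℕ→ℚ ((n ∸ p) ! ℕ.* (n ℕ.+ p) !)) (binom n (k ∸ p)) Q ⟩
  ℕ→ℚ ((n ∸ p) ! ℕ.* (n ℕ.+ p) !) * (binom n (k ∸ p) * Q) ∎
  where
  open ≡-Reasoning
  E = (n ∸ j) ! ℕ.* (n ℕ.+ j) !
  V = T-scale n k
  Q = [1+x]^- n (j ∸ k)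
  regroup : ∀ x a b c → x ℕ.* (a ℕ.* b ℕ.* c) ≡ x ℕ.* a ℕ.* b ℕ.* c
  regroup = ℕ-Ring.solve-∀
  cast : ℕ→ℚ (n !) * binom (n ∸ p) (k ∸ p) * binom (n ℕ.+ p) k ≡ ℕ→ℚ (n ! ℕ.* ((n ∸ p) C (k ∸ p)) ℕ.* ((n ℕ.+ p) C k))
  cast = trans (cong (_* binom (n ℕ.+ p) k) (ℕ→ℚ-*-binom (n !) (n ∸ p) (k ∸ p)))
               (ℕ→ℚ-*-binom (n ! ℕ.* ((n ∸ p) C (k ∸ p))) (n ℕ.+ p) k)

kronecker : ℕ → ℕ → ℚ
kronecker a b with a ℕ.≟ b
... | yes _ = 1ℚ
... | no  _ = 0ℚ

idM-kronecker : ∀ {n} (j p : Fin (suc n)) → idM j p ≡ kronecker (toℕ j) (toℕ p)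
idM-kronecker j p with toℕ j ℕ.≟ toℕ p
... | yes _ = refl
... | no  _ = refl

kronecker-below : ∀ a b → a < b → kronecker a b ≡ 0ℚ
kronecker-below a b a<b with a ℕ.≟ b
... | yes a≡b = contradiction a≡b (ℕP.<⇒≢ a<b)
... | no  _   = refl

kronecker-shift : ∀ p d → kronecker (p ℕ.+ d) p ≡ δ d
kronecker-shift p d with p ℕ.+ d ℕ.≟ p
kronecker-shift p zero    | yes _    = refl
kronecker-shift p (suc d) | yes p+d≡p = contradiction p+d≡p (ℕP.m+1+n≢m p)
kronecker-shift p zero    | no  p≢p  = contradiction (ℕP.+-identityʳ p) p≢p
kronecker-shift p (suc d) | no  _    = refl

module TriangularInverse
  (n : ℕ) (A B : ℕ → ℕ → ℚ) (D : ℕ → ℕ) (D≢0 : ∀ j → NonZero (D j)) (u v : Series)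
  (A-lower : ∀ j k → j < k → A j k ≡ 0ℚ)
  (B-lower : ∀ k p → k < p → B k p ≡ 0ℚ)
  (factorises : ∀ j k p → p ≤ k → k ≤ j → j ≤ n →
                ℕ→ℚ (D j) * (A j k * B k p) ≡ ℕ→ℚ (D p) * (u (k ∸ p) * v (j ∸ k)))
  (u⋆v≈δ : u ⋆ v ≈ δ)
  where

  -- Row p + d: only k = p, …, p + d contribute, and they add up to a
  -- coefficient of u ⋆ v.
  diagonal : ∀ p d → p ℕ.+ d ≤ n → Σ≤ n (λ k → A (p ℕ.+ d) k * B k p) ≡ δ d
  diagonal p d j≤n = ℕ→ℚ-*-cancelˡ (D j) {{D≢0 j}} (begin
    ℕ→ℚ (D j) * Σ≤ n (λ k → A j k * B k p)
      ≡⟨ cong (ℕ→ℚ (D j) *_) (Σ≤-drop-tail j n _ j≤n (λ k j<k → trans (cong (_* B k p) (A-lower j k j<k)) (*-zeroˡ (B k p)))) ⟩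
    ℕ→ℚ (D j) * Σ≤ (p ℕ.+ d) (λ k → A j k * B k p)
      ≡⟨ cong (ℕ→ℚ (D j) *_) (Σ≤-drop-head p d _ (λ k k<p → trans (cong (A j k *_) (B-lower k p k<p)) (*-zeroʳ (A j k)))) ⟩
    ℕ→ℚ (D j) * Σ≤ d (λ t → A j (p ℕ.+ t) * B (p ℕ.+ t) p)
      ≡⟨ Σ≤-*ˡ d (ℕ→ℚ (D j)) _ ⟩
    Σ≤ d (λ t → ℕ→ℚ (D j) * (A j (p ℕ.+ t) * B (p ℕ.+ t) p))
      ≡⟨ Σ≤-cong-≤ d (λ t t≤d → trans (factorises j (p ℕ.+ t) p (ℕP.m≤m+n p t) (ℕP.+-monoʳ-≤ p t≤d) j≤n)
                                   (cong₂ (λ a b → ℕ→ℚ (D p) * (u a * v b)) (ℕP.m+n∸m≡n p t) (ℕP.[m+n]∸[m+o]≡n∸o p d t))) ⟩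
    Σ≤ d (λ t → ℕ→ℚ (D p) * (u t * v (d ∸ t)))
      ≡⟨ sym (Σ≤-*ˡ d (ℕ→ℚ (D p)) _) ⟩
    ℕ→ℚ (D p) * (u ⋆ v) d
      ≡⟨ cong (ℕ→ℚ (D p) *_) (u⋆v≈δ d) ⟩
    ℕ→ℚ (D p) * δ d
      ≡⟨ rescale d ⟩
    ℕ→ℚ (D j) * δ d ∎)
    where
    open ≡-Reasoning
    j = p ℕ.+ d
    rescale : ∀ d → ℕ→ℚ (D p) * δ d ≡ ℕ→ℚ (D (p ℕ.+ d)) * δ d
    rescale zero    = cong (λ i → ℕ→ℚ (D i) * 1ℚ) (sym (ℕP.+-identityʳ p))
    rescale (suc d) = trans (*-zeroʳ (ℕ→ℚ (D p))) (sym (*-zeroʳ (ℕ→ℚ (D (p ℕ.+ suc d)))))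

  off-diagonal : ∀ j p → j < p → Σ≤ n (λ k → A j k * B k p) ≡ 0ℚ
  off-diagonal j p j<p = Σ≤-zero n _ vanish
    where
    vanish : ∀ k → k ≤ n → A j k * B k p ≡ 0ℚ
    vanish k _ with ℕP.≤-<-connex k j
    ... | inj₁ k≤j = trans (cong (A j k *_) (B-lower k p (ℕP.≤-<-trans k≤j j<p))) (*-zeroʳ (A j k))
    ... | inj₂ j<k = trans (cong (_* B k p) (A-lower j k j<k)) (*-zeroˡ (B k p))

  inverse : ∀ j p → j ≤ n → Σ≤ n (λ k → A j k * B k p) ≡ kronecker j p
  inverse j p j≤n = [ on-or-below , above ]′ (ℕP.≤-<-connex p j)
    where
    above : j < p → Σ≤ n (λ k → A j k * B k p) ≡ kronecker j p
    above j<p = trans (off-diagonal j p j<p) (sym (kronecker-below j p j<p))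
    on-or-below : p ≤ j → Σ≤ n (λ k → A j k * B k p) ≡ kronecker j p
    on-or-below p≤j = subst (λ i → Σ≤ n (λ k → A i k * B k p) ≡ kronecker i p) (ℕP.m+[n∸m]≡n p≤j)
      (trans (diagonal p (j ∸ p) (subst (_≤ n) (sym (ℕP.m+[n∸m]≡n p≤j)) j≤n)) (sym (kronecker-shift p (j ∸ p))))

∘M-Σ≤ : ∀ n (A B : Mat n) (A′ B′ : ℕ → ℕ → ℚ) →
  (∀ j k → A j k ≡ A′ (toℕ j) (toℕ k)) → (∀ k p → B k p ≡ B′ (toℕ k) (toℕ p)) →
  ∀ j p → (A ∘M B) j p ≡ Σ≤ n (λ k → A′ (toℕ j) k * B′ k (toℕ p))
∘M-Σ≤ n A B A′ B′ A≡A′ B≡B′ j p = ΣFin-Σ≤ n _ _ (λ k → cong₂ _*_ (A≡A′ j k) (B≡B′ k p))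

theorem14 : (n : ℕ)
    → ((j p : Fin (suc n)) → (S n ∘M T n) j p ≡ idM j p)
    × ((j p : Fin (suc n)) → (T n ∘M S n) j p ≡ idM j p)
theorem14 n = (λ j p → product (S n) (T n) (Sℕ n) (Tℕ n) (S-closed n) (T-closed n) ST.inverse j p)
            , (λ j p → product (T n) (S n) (Tℕ n) (Sℕ n) (T-closed n) (S-closed n) TS.inverse j p)
  where
  module ST = TriangularInverse n (Sℕ n) (Tℕ n) (λ j → j ! ℕ.* (n ∸ j) !) (λ j → j ℕP.!* (n ∸ j) !≢0)
    ([1+x]^- n) ([1+x]^ n) (λ j k → Sℕ-below n j k) (λ k p → Tℕ-below n k p) (ST-entry n) ([1+x]^-inverse n)
  module TS = TriangularInverse n (Tℕ n) (Sℕ n) (λ j → (n ∸ j) ! ℕ.* (n ℕ.+ j) !) (λ j → (n ∸ j) ℕP.!* (n ℕ.+ j) !≢0)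
    ([1+x]^ n) ([1+x]^- n) (λ j k → Tℕ-below n j k) (λ k p → Sℕ-below n k p) (TS-entry n)
    (≈-trans (⋆-comm ([1+x]^ n) ([1+x]^- n)) ([1+x]^-inverse n))
  product : (A B : Mat n) (A′ B′ : ℕ → ℕ → ℚ) → (∀ j k → A j k ≡ A′ (toℕ j) (toℕ k)) → (∀ k p → B k p ≡ B′ (toℕ k) (toℕ p)) →
            (∀ j p → j ≤ n → Σ≤ n (λ k → A′ j k * B′ k p) ≡ kronecker j p) →
            ∀ j p → (A ∘M B) j p ≡ idM j p
  product A B A′ B′ A≡A′ B≡B′ A′B′≡1 j p = begin
    (A ∘M B) j p                              ≡⟨ ∘M-Σ≤ n A B A′ B′ A≡A′ B≡B′ j p ⟩
    Σ≤ n (λ k → A′ (toℕ j) k * B′ k (toℕ p))  ≡⟨ A′B′≡1 (toℕ j) (toℕ p) (FinP.toℕ≤pred[n] j) ⟩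
    kronecker (toℕ j) (toℕ p)                 ≡⟨ sym (idM-kronecker j p) ⟩
    idM j p                                   ∎
    where open ≡-Reasoning
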